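{- Let $A\in M_n(\mathbb{Z})$ have characteristic polynomial $f$ and let $C$ be the companion matrix of $f$. Let $p$ be a prime. Then $A$ is similar to $C$ over $\mathbb{Z}_p$ (i.e. $AP=PC$ for some $P\in GL(n,\mathbb{Z}_p)$) if and only if the reductions of $A$ and $C$ modulo $p$ are similar over $\mathbb{Z}/p\mathbb{Z}$.
   Context: $\mathbb{Z}_p$ denotes the ring of $p$-adic integers. -}

module Defs where

open import Data.Nat as ℕ using (ℕ; zero; suc; _^_; _<_)
open import Data.Nat.Primality using (Prime)
open import Data.Integer as ℤ using (ℤ; +_; -_; _-_)
open import Data.Integer.Divisibility using (_∣_)
open import Data.Fin using (Fin; zero; suc; toℕ; punchIn)
open import Data.List using (List; []; _∷_)
open import Data.Bool using (Bool; true; false; if_then_else_)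
open import Data.Product using (Σ; _×_)

Mat : Set → ℕ → Set
Mat R n = Fin n → Fin n → R

-- Integer polynomials as coefficient lists (constant term first)
Poly : Set
Poly = List ℤ

infixl 6 _+ₚ_
infixl 7 _*ₚ_

_+ₚ_ : Poly → Poly → Poly
[]      +ₚ q       = q
(a ∷ p) +ₚ []      = a ∷ p
(a ∷ p) +ₚ (b ∷ q) = (a ℤ.+ b) ∷ (p +ₚ q)

scaleₚ : ℤ → Poly → Poly
scaleₚ c []      = []
scaleₚ c (a ∷ p) = (c ℤ.* a) ∷ scaleₚ c p

_*ₚ_ : Poly → Poly → Poly
[]      *ₚ q = []
(a ∷ p) *ₚ q = scaleₚ a q +ₚ (+ 0 ∷ (p *ₚ q))

coeff : Poly → ℕ → ℤ
coeff []      k       = + 0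
coeff (a ∷ p) zero    = a
coeff (a ∷ p) (suc k) = coeff p k

sumₚ : ∀ {m} → (Fin m → Poly) → Poly
sumₚ {zero}  f = []
sumₚ {suc m} f = f zero +ₚ sumₚ (λ j → f (suc j))

signℤ : ℕ → ℤ
signℤ zero          = + 1
signℤ (suc zero)    = - + 1
signℤ (suc (suc k)) = signℤ k

detₚ : ∀ n → Mat Poly n → Poly
detₚ zero    M = + 1 ∷ []
detₚ (suc n) M =
  sumₚ (λ j → scaleₚ (signℤ (toℕ j)) (M zero j *ₚ detₚ n (λ i k → M (suc i) (punchIn j k))))

charPoly : ∀ {n} → Mat ℤ n → Poly
charPoly {n} A = detₚ n (λ i j → (- A i j) ∷ ((if toℕ i ℕ.≡ᵇ toℕ j then + 1 else + 0) ∷ []))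

-- companion matrix of a monic f = x^n + c_{n-1} x^{n-1} + ... + c_0 :
-- ones on the subdiagonal, last column (-c_0, ..., -c_{n-1})ᵀ
companion : ∀ n → Poly → Mat ℤ n
companion n f i j =
  if suc (toℕ j) ℕ.≡ᵇ n then - coeff f (toℕ i)
  else (if toℕ i ℕ.≡ᵇ suc (toℕ j) then + 1 else + 0)

sumℤ : ∀ {m} → (Fin m → ℤ) → ℤ
sumℤ {zero}  f = + 0
sumℤ {suc m} f = f zero ℤ.+ sumℤ (λ j → f (suc j))

_·_ : ∀ {n} → Mat ℤ n → Mat ℤ n → Mat ℤ n
(M · N) i k = sumℤ (λ j → M i j ℤ.* N j k)

idMat : ∀ {n} → Mat ℤ n
idMat i j = if toℕ i ℕ.≡ᵇ toℕ j then + 1 else + 0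

CongMod : ℕ → ℤ → ℤ → Set
CongMod m a b = (+ m) ∣ (a - b)

MatCongMod : ∀ {n} → ℕ → Mat ℤ n → Mat ℤ n → Set
MatCongMod m M N = ∀ i j → CongMod m (M i j) (N i j)

-- ℤ/pℤ: matrices over ℤ/pℤ are represented by integer matrices whose
-- entries are read modulo p.  Reductions mod p of A and C are similar
-- over ℤ/pℤ iff there are Q, R with A Q = Q C, Q R = I, R Q = I mod p.
SimilarModP : ∀ {n} → ℕ → Mat ℤ n → Mat ℤ n → Set
SimilarModP {n} p A C =
  Σ (Mat ℤ n) λ Q → Σ (Mat ℤ n) λ R →
    MatCongMod p (A · Q) (Q · C) × MatCongMod p (Q · R) idMat × MatCongMod p (R · Q) idMat

-- p-adic integers ℤ_p = lim ℤ/p^k ZZ: compatible sequences of residues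
record ℤ[_] (p : ℕ) : Set where
  field
    digit  : ℕ → ℕ                          -- x mod p^k
    bound  : ∀ k → digit k < p ^ k
    compat : ∀ k → CongMod (p ^ k) (+ digit (suc k)) (+ digit k)
open ℤ[_] public

level : ∀ {p n} → Mat ℤ[ p ] n → ℕ → Mat ℤ n
level P k i j = + digit (P i j) k

-- Ring operations of ℤ_p = lim ℤ/p^k are computed levelwise, and two
-- p-adic integers are equal iff all their projections to ℤ/p^k agree;
-- so each matrix equation in ℤ_p is stated at every level k.
SimilarOverℤp : ∀ {n} → ℕ → Mat ℤ n → Mat ℤ n → Set
SimilarOverℤp {n} p A C =
  Σ (Mat ℤ[ p ] n) λ P → Σ (Mat ℤ[ p ] n) λ Q → ∀ k →
    MatCongMod (p ^ k) (A · level P k) (level P k · C)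
    × MatCongMod (p ^ k) (level P k · level Q k) idMat
    × MatCongMod (p ^ k) (level Q k · level P k) idMat

-- If AP = PC with P ∈ GL(n, ℤ_p), reducing modulo p gives a similarity over ℤ/pℤ.
-- Conversely, let AQ ≡ QC (mod p) with Q invertible modulo p, and let v be the first column
-- of Q. Since C shifts the standard basis, the columns of Q are congruent to v, Av, …, Aⁿ⁻¹v:
-- Q is congruent to the Krylov matrix K of v. The last column of C holds the coefficients of
-- the characteristic polynomial, so by Cayley–Hamilton AK = KC holds exactly over ℤ. Being
-- invertible modulo p, K is invertible modulo every pᵏ by Newton iteration, and these inverses
-- form a p-adic matrix: K ∈ GL(n, ℤ_p). Primality of p is used only to know p ≠ 0.
module Submission where

open import Algebra.Bundles using (Ring; CommutativeRing; RawRing; Semiring)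
open import Algebra.Definitions using (Congruent₁; Congruent₂)
open import Algebra.Morphism.Structures using (IsRingMonomorphism)
import Algebra.Morphism.RingMonomorphism as RingMonomorphism
open import Data.Bool using (true; false; if_then_else_)
open import Data.Empty using (⊥-elim)
open import Data.Fin as Fin using (Fin; zero; suc; toℕ; inject₁; lower₁; punchIn; punchOut)
open import Data.Fin.Induction using (<-weakInduction)
open import Data.Fin.Properties
  using (punchInᵢ≢i; punchOut-punchIn; punchOut-cong; toℕ-injective; toℕ-inject₁; toℕ<n; inject₁-lower₁)
open import Data.Integer as ℤ using (ℤ; +_)
import Data.Integer.Properties as ℤₚ
open import Data.Integer.Divisibility.Signed
  using (divides; ∣ᵤ⇒∣; ∣⇒∣ᵤ; ∣-refl; ∣-trans; ∣m∣n⇒∣m+n; ∣m⇒∣-m; ∣n⇒∣m*n; ∣m⇒∣m*n; *-monoˡ-∣; *-monoʳ-∣)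
  renaming (_∣_ to _∣ₛ_)
open import Data.Integer.DivMod using (_%ℕ_; _/ℕ_; a≡a%ℕn+[a/ℕn]*n; n%ℕd<d)
open import Data.Integer.Tactic.RingSolver using (solve-∀)
open import Data.List using ([]; _∷_; drop)
open import Data.Nat as ℕ using (ℕ; zero; suc; NonZero; _^_)
import Data.Nat.Properties as ℕₚ
open import Data.Nat.Primality using (Prime; prime⇒nonZero)
open import Data.Product using (_,_; proj₁; proj₂)
open import Data.Sum using (_⊎_; inj₁; inj₂)
open import Data.Vec.Functional using (Vector; updateAt; foldr)
open import Data.Vec.Functional.Properties using (updateAt-updates; updateAt-minimal)
open import Function using (id; _∘_; const)
open import Function.Bundles using (_⇔_; mk⇔)
open import Level using (0ℓ)
open import Relation.Binary using (Rel; IsEquivalence; _⇒_)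
open import Relation.Binary.PropositionalEquality as ≡ using (_≡_; _≢_)
open import Relation.Nullary using (yes; no)

open import Defs

module RingSums {c ℓ} (R : Ring c ℓ) where
  open Ring R
  open import Algebra.Properties.Ring R using (-‿+-comm; -0#≈0#)
  open import Algebra.Properties.Semiring.Sum semiring public

  sum-zero : ∀ {n} (f : Vector Carrier n) → (∀ i → f i ≈ 0#) → sum f ≈ 0#
  sum-zero {n} f f≈0 = trans (sum-cong-≋ f≈0) (sum-replicate-zero n)

  -‿distrib-sum : ∀ {n} (f : Vector Carrier n) → - sum f ≈ ∑[ i < n ] (- f i)
  -‿distrib-sum {zero}  f = -0#≈0#
  -‿distrib-sum {suc n} f = trans (sym (-‿+-comm _ _)) (+-congˡ (-‿distrib-sum (f ∘ suc)))

  sum-single : ∀ {n} (i : Fin n) (f : Vector Carrier n) → (∀ j → j ≢ i → f j ≈ 0#) → sum f ≈ f i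
  sum-single {suc n} i f f≈0 = begin
    sum f                               ≈⟨ sum-remove f ⟩
    f i + ∑[ j < n ] f (punchIn i j)     ≈⟨ +-congˡ (sum-zero _ (λ j → f≈0 _ (punchInᵢ≢i i j))) ⟩
    f i + 0#                            ≈⟨ +-identityʳ _ ⟩
    f i                                 ∎
    where open import Relation.Binary.Reasoning.Setoid setoid

-- Determinants over a commutative ring

adjacentSwap : ∀ {n} → Fin n → Fin (suc n) → Fin (suc n)
adjacentSwap zero    zero          = suc zero
adjacentSwap zero    (suc zero)    = zero
adjacentSwap zero    (suc (suc k)) = suc (suc k)
adjacentSwap (suc i) zero          = zero
adjacentSwap (suc i) (suc k)       = suc (adjacentSwap i k)

adjacentSwap-involutive : ∀ {n} (i : Fin n) k → adjacentSwap i (adjacentSwap i k) ≡ k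
adjacentSwap-involutive zero    zero          = ≡.refl
adjacentSwap-involutive zero    (suc zero)    = ≡.refl
adjacentSwap-involutive zero    (suc (suc k)) = ≡.refl
adjacentSwap-involutive (suc i) zero          = ≡.refl
adjacentSwap-involutive (suc i) (suc k)       = ≡.cong suc (adjacentSwap-involutive i k)

adjacentSwap-inject₁ : ∀ {n} (i : Fin n) → adjacentSwap i (inject₁ i) ≡ suc i
adjacentSwap-inject₁ zero    = ≡.refl
adjacentSwap-inject₁ (suc i) = ≡.cong suc (adjacentSwap-inject₁ i)

adjacentSwap-punchIn : ∀ {n} (i k : Fin n) → adjacentSwap i (punchIn (inject₁ i) k) ≡ punchIn (suc i) k
adjacentSwap-punchIn zero    zero    = ≡.refl
adjacentSwap-punchIn zero    (suc k) = ≡.refl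
adjacentSwap-punchIn (suc i) zero    = ≡.refl
adjacentSwap-punchIn (suc i) (suc k) = ≡.cong suc (adjacentSwap-punchIn i k)

punchIn-punchOut-comm : ∀ {m} {a b : Fin (suc (suc m))} (a≢b : a ≢ b) (b≢a : b ≢ a) (k : Fin m) →
  punchIn a (punchIn (punchOut a≢b) k) ≡ punchIn b (punchIn (punchOut b≢a) k)
punchIn-punchOut-comm {a = zero}  {zero}  a≢b _ k = ⊥-elim (a≢b ≡.refl)
punchIn-punchOut-comm {a = zero}  {suc b} _   _ k = ≡.refl
punchIn-punchOut-comm {a = suc a} {zero}  _   _ k = ≡.refl
punchIn-punchOut-comm {suc m} {suc a} {suc b} _ _ zero = ≡.refl
punchIn-punchOut-comm {suc m} {suc a} {suc b} a≢b b≢a (suc k) =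
  ≡.cong suc (punchIn-punchOut-comm (a≢b ∘ ≡.cong suc) (b≢a ∘ ≡.cong suc) k)

-- In the Laplace expansion along the first two rows, the term using columns a ≢ b carries
-- the sign (−1) ^ crossIndex.
crossIndex : ∀ {m} {a b : Fin (suc m)} → a ≢ b → ℕ
crossIndex {a = a} a≢b = toℕ a ℕ.+ toℕ (punchOut a≢b)

crossIndex-suc : ∀ {m} {a b : Fin (suc m)} (a≢b : suc a ≢ suc b) →
  crossIndex a≢b ≡ suc (suc (crossIndex (a≢b ∘ ≡.cong suc)))
crossIndex-suc {a = a} _ = ≡.cong suc (ℕₚ.+-suc (toℕ a) _)

crossIndex-parity : ∀ {m} {a b : Fin (suc m)} (a≢b : a ≢ b) (b≢a : b ≢ a) →
  suc (crossIndex a≢b) ≡ crossIndex b≢a ⊎ suc (crossIndex b≢a) ≡ crossIndex a≢b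
crossIndex-parity {a = zero}  {zero}  a≢b _ = ⊥-elim (a≢b ≡.refl)
crossIndex-parity {suc m} {zero}  {suc b} _ _ = inj₁ (≡.cong suc (≡.sym (ℕₚ.+-identityʳ (toℕ b))))
crossIndex-parity {suc m} {suc a} {zero}  _ _ = inj₂ (≡.cong suc (≡.sym (ℕₚ.+-identityʳ (toℕ a))))
crossIndex-parity {suc m} {suc a} {suc b} a≢b b≢a
  with crossIndex-parity (a≢b ∘ ≡.cong suc) (b≢a ∘ ≡.cong suc)
... | inj₁ e = inj₁ (≡.trans (≡.cong suc (crossIndex-suc a≢b))
                    (≡.trans (≡.cong (ℕ.suc ∘ ℕ.suc) e) (≡.sym (crossIndex-suc b≢a))))
... | inj₂ e = inj₂ (≡.trans (≡.cong suc (crossIndex-suc b≢a))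
                    (≡.trans (≡.cong (ℕ.suc ∘ ℕ.suc) e) (≡.sym (crossIndex-suc a≢b))))

module Determinant {ℓ} (R : CommutativeRing 0ℓ ℓ) where
  open CommutativeRing R hiding (zero)
  open RingSums ring
  open import Algebra.Properties.Ring ring using (-‿distribˡ-*; -‿distribʳ-*; -‿involutive; -0#≈0#)
  open import Algebra.Properties.Group +-group using (inverseʳ-unique)
  open import Algebra.Solver.CommutativeMonoid *-commutativeMonoid using (solve; _⊕_; _⊜_)
  open import Relation.Binary.Reasoning.Setoid setoid

  sign : ℕ → Carrier
  sign zero    = 1#
  sign (suc k) = - sign k

  sign-+ : ∀ m n → sign (m ℕ.+ n) ≈ sign m * sign n
  sign-+ zero    n = sym (*-identityˡ _)
  sign-+ (suc m) n = trans (-‿cong (sign-+ m n)) (-‿distribˡ-* _ _)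

  sign-parity : ∀ {m n} → suc m ≡ n ⊎ suc n ≡ m → sign n ≈ - sign m
  sign-parity (inj₁ ≡.refl) = refl
  sign-parity (inj₂ ≡.refl) = sym (-‿involutive _)

  minor : ∀ {n} → Mat Carrier (suc n) → Fin (suc n) → Fin (suc n) → Mat Carrier n
  minor M i j r c = M (punchIn i r) (punchIn j c)

  det : ∀ n → Mat Carrier n → Carrier
  cofactor : ∀ {n} → Mat Carrier (suc n) → Fin (suc n) → Fin (suc n) → Carrier

  det zero    M = 1#
  det (suc n) M = ∑[ j < suc n ] (M zero j * cofactor M zero j)

  cofactor {n} M i j = sign (toℕ i ℕ.+ toℕ j) * det n (minor M i j)

  det-cong : ∀ n {M N : Mat Carrier n} → (∀ i j → M i j ≈ N i j) → det n M ≈ det n N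
  det-cong zero    M≈N = refl
  det-cong (suc n) M≈N =
    sum-cong-≋ (λ j → *-cong (M≈N zero j) (*-congˡ {sign (toℕ j)} (det-cong n (λ r c → M≈N (suc r) (punchIn j c)))))

  -- Pairing G a b with G b a only over a < b avoids dividing by 2.
  sum²-antisymmetric : ∀ {m} (G : Fin m → Fin m → Carrier) →
    (∀ a → G a a ≈ 0#) → (∀ a b → a ≢ b → G b a ≈ - G a b) →
    ∑[ a < m ] ∑[ b < m ] G a b ≈ 0#
  sum²-antisymmetric {m} G G-diag G-anti = begin
    ∑[ a < m ] ∑[ b < m ] G a b
      ≈⟨ sum-cong-≋ (λ a → sum-cong-≋ (λ b → G≈upper-upperᵀ a b)) ⟩
    ∑[ a < m ] ∑[ b < m ] (upper a b - upper b a)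
      ≈⟨ sum-cong-≋ (λ a → ∑-distrib-+ (upper a) (λ b → - upper b a)) ⟩
    ∑[ a < m ] (∑[ b < m ] upper a b + ∑[ b < m ] (- upper b a))
      ≈⟨ ∑-distrib-+ (λ a → ∑[ b < m ] upper a b) (λ a → ∑[ b < m ] (- upper b a)) ⟩
    ∑[ a < m ] ∑[ b < m ] upper a b + ∑[ a < m ] ∑[ b < m ] (- upper b a)
      ≈⟨ +-congˡ (∑-comm (λ a b → - upper b a)) ⟩
    ∑[ a < m ] ∑[ b < m ] upper a b + ∑[ b < m ] ∑[ a < m ] (- upper b a)
      ≈⟨ +-congˡ (trans (sum-cong-≋ (λ b → sym (-‿distrib-sum (upper b)))) (sym (-‿distrib-sum (λ b → ∑[ a < m ] upper b a)))) ⟩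
    ∑[ a < m ] ∑[ b < m ] upper a b - ∑[ b < m ] ∑[ a < m ] upper b a
      ≈⟨ -‿inverseʳ _ ⟩
    0# ∎
    where
    upper : Fin m → Fin m → Carrier
    upper a b with toℕ a ℕ.<? toℕ b
    ... | yes _ = G a b
    ... | no  _ = 0#

    G≈upper-upperᵀ : ∀ a b → G a b ≈ upper a b - upper b a
    G≈upper-upperᵀ a b with toℕ a ℕ.<? toℕ b | toℕ b ℕ.<? toℕ a
    ... | yes a<b | yes b<a = ⊥-elim (ℕₚ.<-asym a<b b<a)
    ... | yes _   | no  _   = sym (trans (+-congˡ -0#≈0#) (+-identityʳ _))
    ... | no  _   | yes b<a = begin
      G a b         ≈⟨ sym (-‿involutive _) ⟩
      - - G a b     ≈⟨ -‿cong (sym (G-anti a b (λ a≡b → ℕₚ.<-irrefl (≡.cong toℕ (≡.sym a≡b)) b<a))) ⟩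
      - G b a       ≈⟨ sym (+-identityˡ _) ⟩
      0# - G b a    ∎
    ... | no a≮b  | no b≮a with toℕ-injective (ℕₚ.≤-antisym (ℕₚ.≮⇒≥ b≮a) (ℕₚ.≮⇒≥ a≮b))
    ...   | ≡.refl = trans (G-diag a) (sym (trans (+-congˡ -0#≈0#) (+-identityʳ _)))

  module _ {n} (N : Fin n → Fin (suc (suc n)) → Carrier) where

    complementary : Fin (suc (suc n)) → Fin (suc n) → Carrier
    complementary a l = det n (λ r c → N r (punchIn a (punchIn l c)))

    cofactor₂ : Fin (suc (suc n)) → Fin (suc (suc n)) → Carrier
    cofactor₂ a b with a Fin.≟ b
    ... | yes _   = 0#
    ... | no  a≢b = sign (crossIndex a≢b) * complementary a (punchOut a≢b)

    cofactor₂-diag : ∀ a → cofactor₂ a a ≈ 0#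
    cofactor₂-diag a with a Fin.≟ a
    ... | yes _   = refl
    ... | no  a≢a = ⊥-elim (a≢a ≡.refl)

    cofactor₂-punchIn : ∀ a l → cofactor₂ a (punchIn a l) ≈ sign (toℕ a ℕ.+ toℕ l) * complementary a l
    cofactor₂-punchIn a l with a Fin.≟ punchIn a l
    ... | yes a≡ = ⊥-elim (punchInᵢ≢i a l (≡.sym a≡))
    ... | no  a≢ = reflexive (≡.cong₂ (λ x y → sign (toℕ a ℕ.+ toℕ x) * complementary a y) out out)
      where out = ≡.trans (punchOut-cong a ≡.refl) (punchOut-punchIn a)

    cofactor₂-antisym : ∀ a b → a ≢ b → cofactor₂ b a ≈ - cofactor₂ a b
    cofactor₂-antisym a b a≢b with a Fin.≟ b | b Fin.≟ a
    ... | yes a≡b | _       = ⊥-elim (a≢b a≡b)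
    ... | no  _   | yes b≡a = ⊥-elim (a≢b (≡.sym b≡a))
    ... | no  a≢b′ | no b≢a = begin
      sign (crossIndex b≢a) * complementary b (punchOut b≢a)
        ≈⟨ *-cong (sign-parity (crossIndex-parity a≢b′ b≢a)) same-minor ⟩
      - sign (crossIndex a≢b′) * complementary a (punchOut a≢b′)
        ≈⟨ sym (-‿distribˡ-* _ _) ⟩
      - (sign (crossIndex a≢b′) * complementary a (punchOut a≢b′)) ∎
      where
      same-minor : complementary b (punchOut b≢a) ≈ complementary a (punchOut a≢b′)
      same-minor = det-cong n (λ r c → reflexive (≡.cong (N r) (punchIn-punchOut-comm b≢a a≢b′ c)))

  det-expand-top-rows : ∀ {n} (M : Mat Carrier (suc (suc n))) →
    det _ M ≈ ∑[ a < suc (suc n) ] ∑[ b < suc (suc n) ]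
                (M zero a * M (suc zero) b * cofactor₂ (λ r → M (suc (suc r))) a b)
  det-expand-top-rows {n} M = begin
    ∑[ a < 2+n ] (u a * (sign (toℕ a) * ∑[ l < 1+n ] (w (punchIn a l) * (sign (toℕ l) * D a l))))
      ≈⟨ sum-cong-≋ distribute ⟩
    ∑[ a < 2+n ] ∑[ l < 1+n ] (u a * (sign (toℕ a) * (w (punchIn a l) * (sign (toℕ l) * D a l))))
      ≈⟨ sum-cong-≋ (λ a → sum-cong-≋ (λ l → regroup a l)) ⟩
    ∑[ a < 2+n ] ∑[ l < 1+n ] (u a * w (punchIn a l) * κ a (punchIn a l))
      ≈⟨ sum-cong-≋ (λ a → sym (add-diagonal a)) ⟩
    ∑[ a < 2+n ] ∑[ b < 2+n ] (u a * w b * κ a b) ∎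
    where
    2+n = suc (suc n)
    1+n = suc n
    u = M zero
    w = M (suc zero)
    N = λ r → M (suc (suc r))
    κ = cofactor₂ N
    D = complementary N

    distribute : ∀ a → u a * (sign (toℕ a) * ∑[ l < 1+n ] (w (punchIn a l) * (sign (toℕ l) * D a l)))
                     ≈ ∑[ l < 1+n ] (u a * (sign (toℕ a) * (w (punchIn a l) * (sign (toℕ l) * D a l))))
    distribute a = trans (*-congˡ (*-distribˡ-sum (sign (toℕ a)) (λ l → w (punchIn a l) * (sign (toℕ l) * D a l))))
                         (*-distribˡ-sum (u a) (λ l → sign (toℕ a) * (w (punchIn a l) * (sign (toℕ l) * D a l))))

    regroup : ∀ a l → u a * (sign (toℕ a) * (w (punchIn a l) * (sign (toℕ l) * D a l)))
                    ≈ u a * w (punchIn a l) * κ a (punchIn a l)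
    regroup a l = begin
      u a * (sign (toℕ a) * (w (punchIn a l) * (sign (toℕ l) * D a l)))
        ≈⟨ solve 5 (λ x s y t d → x ⊕ (s ⊕ (y ⊕ (t ⊕ d))) ⊜ (x ⊕ y) ⊕ ((s ⊕ t) ⊕ d)) refl
                 (u a) (sign (toℕ a)) (w (punchIn a l)) (sign (toℕ l)) (D a l) ⟩
      u a * w (punchIn a l) * (sign (toℕ a) * sign (toℕ l) * D a l)
        ≈⟨ *-congˡ (trans (*-congʳ (sym (sign-+ (toℕ a) (toℕ l)))) (sym (cofactor₂-punchIn N a l))) ⟩
      u a * w (punchIn a l) * κ a (punchIn a l) ∎

    add-diagonal : ∀ a → ∑[ b < 2+n ] (u a * w b * κ a b)
                       ≈ ∑[ l < 1+n ] (u a * w (punchIn a l) * κ a (punchIn a l))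
    add-diagonal a = trans (sum-remove {i = a} (λ b → u a * w b * κ a b))
      (trans (+-congʳ (trans (*-congˡ (cofactor₂-diag N a)) (zeroʳ _))) (+-identityˡ _))

  det-top-rows-equal : ∀ {n} (M : Mat Carrier (suc (suc n))) →
    (∀ c → M zero c ≈ M (suc zero) c) → det _ M ≈ 0#
  det-top-rows-equal M u≈w = begin
    det _ M                                  ≈⟨ det-expand-top-rows M ⟩
    ∑[ a < _ ] ∑[ b < _ ] (u a * w b * κ a b) ≈⟨ sum-cong-≋ (λ a → sum-cong-≋ (λ b → *-congʳ {κ a b} (*-congˡ {u a} (sym (u≈w b))))) ⟩
    ∑[ a < _ ] ∑[ b < _ ] (u a * u b * κ a b) ≈⟨ sum²-antisymmetric _ diag anti ⟩
    0#                                       ∎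
    where
    u = M zero
    w = M (suc zero)
    κ = cofactor₂ (λ r → M (suc (suc r)))
    diag : ∀ a → u a * u a * κ a a ≈ 0#
    diag a = trans (*-congˡ (cofactor₂-diag _ a)) (zeroʳ _)
    anti : ∀ a b → a ≢ b → u b * u a * κ b a ≈ - (u a * u b * κ a b)
    anti a b a≢b = trans (*-cong (*-comm _ _) (cofactor₂-antisym _ a b a≢b)) (sym (-‿distribʳ-* _ _))

  det-swap-top-rows : ∀ {n} (M : Mat Carrier (suc (suc n))) →
    det _ (M ∘ adjacentSwap zero) ≈ - det _ M
  det-swap-top-rows M = inverseʳ-unique (det _ M) (det _ (M ∘ adjacentSwap zero)) (begin
    det _ M + det _ (M ∘ adjacentSwap zero)
      ≈⟨ +-cong (det-expand-top-rows M) (det-expand-top-rows (M ∘ adjacentSwap zero)) ⟩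
    ∑[ a < _ ] ∑[ b < _ ] (u a * w b * κ a b) + ∑[ a < _ ] ∑[ b < _ ] (w a * u b * κ a b)
      ≈⟨ sym (∑-distrib-+ (λ a → ∑[ b < _ ] (u a * w b * κ a b)) (λ a → ∑[ b < _ ] (w a * u b * κ a b))) ⟩
    ∑[ a < _ ] (∑[ b < _ ] (u a * w b * κ a b) + ∑[ b < _ ] (w a * u b * κ a b))
      ≈⟨ sum-cong-≋ (λ a → sym (∑-distrib-+ (λ b → u a * w b * κ a b) (λ b → w a * u b * κ a b))) ⟩
    ∑[ a < _ ] ∑[ b < _ ] (u a * w b * κ a b + w a * u b * κ a b)
      ≈⟨ sum-cong-≋ (λ a → sum-cong-≋ (λ b → sym (distribʳ (κ a b) (u a * w b) (w a * u b)))) ⟩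
    ∑[ a < _ ] ∑[ b < _ ] ((u a * w b + w a * u b) * κ a b)
      ≈⟨ sum²-antisymmetric _ diag anti ⟩
    0# ∎)
    where
    u = M zero
    w = M (suc zero)
    κ = cofactor₂ (λ r → M (suc (suc r)))
    diag : ∀ a → (u a * w a + w a * u a) * κ a a ≈ 0#
    diag a = trans (*-congˡ (cofactor₂-diag _ a)) (zeroʳ _)
    anti : ∀ a b → a ≢ b → (u b * w a + w b * u a) * κ b a ≈ - ((u a * w b + w a * u b) * κ a b)
    anti a b a≢b = trans (*-cong (trans (+-cong (*-comm _ _) (*-comm _ _)) (+-comm _ _))
                                 (cofactor₂-antisym _ a b a≢b))
                         (sym (-‿distribʳ-* _ _))

  det-adjacentSwap : ∀ n (i : Fin n) (M : Mat Carrier (suc n)) →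
    det (suc n) (M ∘ adjacentSwap i) ≈ - det (suc n) M
  det-adjacentSwap (suc n) zero    M = det-swap-top-rows M
  det-adjacentSwap (suc n) (suc i) M = begin
    ∑[ j < _ ] (M zero j * (sign (toℕ j) * det (suc n) (minor M zero j ∘ adjacentSwap i)))
      ≈⟨ sum-cong-≋ (λ j → trans (*-congˡ {M zero j} (trans (*-congˡ {sign (toℕ j)} (det-adjacentSwap n i (minor M zero j)))
                                                   (sym (-‿distribʳ-* _ _))))
                                   (sym (-‿distribʳ-* _ _))) ⟩
    ∑[ j < _ ] (- (M zero j * (sign (toℕ j) * det (suc n) (minor M zero j))))
      ≈⟨ sym (-‿distrib-sum (λ j → M zero j * (sign (toℕ j) * det (suc n) (minor M zero j)))) ⟩
    - det (suc (suc n)) M ∎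

  det-adjacentSwap⁻¹ : ∀ n (i : Fin n) (M : Mat Carrier (suc n)) →
    det (suc n) M ≈ - det (suc n) (M ∘ adjacentSwap i)
  det-adjacentSwap⁻¹ n i M =
    trans (det-cong (suc n) (λ r c → reflexive (≡.cong (λ x → M x c) (≡.sym (adjacentSwap-involutive i r)))))
          (det-adjacentSwap n i (M ∘ adjacentSwap i))

  DetAlternating : ℕ → Set ℓ
  DetAlternating n = ∀ (M : Mat Carrier n) a b → a ≢ b → (∀ c → M a c ≈ M b c) → det n M ≈ 0#

  det-equal-lower-rows : ∀ {n} → DetAlternating n → ∀ (M : Mat Carrier (suc n)) a b → a ≢ b →
    (∀ c → M (suc a) c ≈ M (suc b) c) → det (suc n) M ≈ 0#
  det-equal-lower-rows alt M a b a≢b Ma≈Mb = sum-zero _ (λ j →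
    trans (*-congˡ {M zero j} (trans (*-congˡ {sign (toℕ j)} (alt (minor M zero j) a b a≢b (λ c → Ma≈Mb (punchIn j c))))
                                     (zeroʳ _)))
          (zeroʳ _))

  det-equal-top-row : ∀ {n} → DetAlternating n → ∀ (M : Mat Carrier (suc n)) b →
    (∀ c → M zero c ≈ M (suc b) c) → det (suc n) M ≈ 0#
  det-equal-top-row {suc n} alt M zero    M0≈M1 = det-top-rows-equal M M0≈M1
  det-equal-top-row {suc n} alt M (suc b) M0≈Mb = begin
    det _ M                           ≈⟨ det-adjacentSwap⁻¹ (suc n) zero M ⟩
    - det _ (M ∘ adjacentSwap zero)    ≈⟨ -‿cong (det-equal-lower-rows alt (M ∘ adjacentSwap zero) zero (suc b) (λ ()) M0≈Mb) ⟩
    - 0#                              ≈⟨ -0#≈0# ⟩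
    0#                                ∎

  det-alternating : ∀ n → DetAlternating n
  det-alternating (suc n) M zero    zero    0≢0 _ = ⊥-elim (0≢0 ≡.refl)
  det-alternating (suc n) M zero    (suc b) _   e = det-equal-top-row (det-alternating n) M b e
  det-alternating (suc n) M (suc a) zero    _   e = det-equal-top-row (det-alternating n) M a (sym ∘ e)
  det-alternating (suc n) M (suc a) (suc b) a≢b e =
    det-equal-lower-rows (det-alternating n) M a b (a≢b ∘ ≡.cong suc) e

  det-expand-row : ∀ {n} (M : Mat Carrier (suc n)) i →
    det (suc n) M ≈ ∑[ j < suc n ] (M i j * cofactor M i j)
  det-expand-row {n} M i = <-weakInduction ExpandsAlong (λ _ → refl) next i M
    where
    ExpandsAlong : Fin (suc n) → Set ℓ
    ExpandsAlong i = ∀ M → det (suc n) M ≈ ∑[ j < suc n ] (M i j * cofactor M i j)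

    next : ∀ i → ExpandsAlong (inject₁ i) → ExpandsAlong (suc i)
    next i expand M = begin
      det _ M
        ≈⟨ det-adjacentSwap⁻¹ n i M ⟩
      - det _ M′
        ≈⟨ -‿cong (expand M′) ⟩
      - ∑[ j < suc n ] (M′ (inject₁ i) j * cofactor M′ (inject₁ i) j)
        ≈⟨ -‿distrib-sum (λ j → M′ (inject₁ i) j * cofactor M′ (inject₁ i) j) ⟩
      ∑[ j < suc n ] (- (M′ (inject₁ i) j * cofactor M′ (inject₁ i) j))
        ≈⟨ sum-cong-≋ moved-term ⟩
      ∑[ j < suc n ] (M (suc i) j * cofactor M (suc i) j) ∎
      where
      M′ = M ∘ adjacentSwap i
      moved-term : ∀ j → - (M′ (inject₁ i) j * cofactor M′ (inject₁ i) j) ≈ M (suc i) j * cofactor M (suc i) j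
      moved-term j = trans (-‿distribʳ-* _ _) (*-cong
        (reflexive (≡.cong (λ r → M r j) (adjacentSwap-inject₁ i)))
        (trans (-‿distribˡ-* _ _) (*-cong
          (reflexive (≡.cong (λ x → - sign (x ℕ.+ toℕ j)) (toℕ-inject₁ i)))
          (det-cong n (λ r c → reflexive (≡.cong (λ x → M x (punchIn j c)) (adjacentSwap-punchIn i r)))))))

  alien-cofactor-expansion : ∀ {n} (M : Mat Carrier (suc n)) {i k} → i ≢ k →
    ∑[ j < suc n ] (M i j * cofactor M k j) ≈ 0#
  alien-cofactor-expansion {n} M {i} {k} i≢k = begin
    ∑[ j < suc n ] (M i j * cofactor M k j)
      ≈⟨ sum-cong-≋ (λ j → *-cong (reflexive (≡.cong (λ r → r j) (≡.sym M′k≡Mi)))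
                                  (*-congˡ {sign (toℕ k ℕ.+ toℕ j)} (det-cong n (λ r c → reflexive (≡.cong (λ x → x (punchIn j c))
                                            (≡.sym (updateAt-minimal _ k {const (M i)} M (punchInᵢ≢i k r)))))))) ⟩
    ∑[ j < suc n ] (M′ k j * cofactor M′ k j)
      ≈⟨ sym (det-expand-row M′ k) ⟩
    det _ M′
      ≈⟨ det-alternating _ M′ k i (i≢k ∘ ≡.sym)
           (λ c → reflexive (≡.cong (λ r → r c) (≡.trans M′k≡Mi (≡.sym (updateAt-minimal i k M i≢k))))) ⟩
    0# ∎
    where
    M′ = updateAt M k (const (M i))
    M′k≡Mi : M′ k ≡ M i
    M′k≡Mi = updateAt-updates k M

-- The operations are opaque so that unification sees matrix expressions rather than their
-- entries, and they depend only on the raw operations so that integer matrices and matrices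
-- modulo m share them.
module MatrixOperations {A : Set} (_+_ _*_ : A → A → A) (-_ : A → A) (0# : A) where

  infixl 6 _+ᴹ_
  infixl 7 _*ᴹ_
  infixr 8 _•_

  opaque
    _+ᴹ_ _*ᴹ_ : ∀ {n} → Mat A n → Mat A n → Mat A n
    (M +ᴹ N) i j = M i j + N i j
    (M *ᴹ N) i k = foldr _+_ 0# (λ j → M i j * N j k)

    -ᴹ_ : ∀ {n} → Mat A n → Mat A n
    (-ᴹ M) i j = - M i j

    _•_ : ∀ {n} → A → Mat A n → Mat A n
    (a • M) i j = a * M i j

  opaque
    unfolding _+ᴹ_ _*ᴹ_ -ᴹ_ _•_

    +ᴹ-entry : ∀ {n} (M N : Mat A n) i j → (M +ᴹ N) i j ≡ M i j + N i j
    +ᴹ-entry M N i j = ≡.refl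

    *ᴹ-entry : ∀ {n} (M N : Mat A n) i k → (M *ᴹ N) i k ≡ foldr _+_ 0# (λ j → M i j * N j k)
    *ᴹ-entry M N i k = ≡.refl

    -ᴹ-entry : ∀ {n} (M : Mat A n) i j → (-ᴹ M) i j ≡ - M i j
    -ᴹ-entry M i j = ≡.refl

    •-entry : ∀ {n} a (M : Mat A n) i j → (a • M) i j ≡ a * M i j
    •-entry a M i j = ≡.refl

module Matrices {ℓ} (R : CommutativeRing 0ℓ ℓ) (n : ℕ) where
  open CommutativeRing R hiding (zero)
  open RingSums ring
  open MatrixOperations _+_ _*_ -_ 0# public
  open import Relation.Binary.Reasoning.Setoid setoid

  Matrix : Set
  Matrix = Mat Carrier n

  δ : Fin n → Fin n → Carrier
  δ i j = if toℕ i ℕ.≡ᵇ toℕ j then 1# else 0#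

  δ-diag : ∀ i → δ i i ≡ 1#
  δ-diag i with toℕ i ℕ.≡ᵇ toℕ i | ℕₚ.≡⇒≡ᵇ (toℕ i) (toℕ i) ≡.refl
  ... | true | _ = ≡.refl

  δ-off : ∀ {i j} → i ≢ j → δ i j ≡ 0#
  δ-off {i} {j} i≢j with toℕ i ℕ.≡ᵇ toℕ j | ℕₚ.≡ᵇ⇒≡ (toℕ i) (toℕ j)
  ... | false | _     = ≡.refl
  ... | true  | toℕ≡ = ⊥-elim (i≢j (toℕ-injective (toℕ≡ _)))

  infix 4 _≈ᴹ_
  record _≈ᴹ_ (M N : Matrix) : Set ℓ where
    constructor entrywise
    field entry : ∀ i j → M i j ≈ N i j
  open _≈ᴹ_ public

  0ᴹ 1ᴹ : Matrix
  0ᴹ i j = 0#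
  1ᴹ = δ

  private
    +ᴹ-pointwise : ∀ {L M N : Matrix} → (∀ i j → L i j + M i j ≈ N i j) → L +ᴹ M ≈ᴹ N
    +ᴹ-pointwise {L} {M} e = entrywise λ i j → trans (reflexive (+ᴹ-entry L M i j)) (e i j)

    *ᴹ-assoc : ∀ L M N → (L *ᴹ M) *ᴹ N ≈ᴹ L *ᴹ (M *ᴹ N)
    *ᴹ-assoc L M N = entrywise λ i l → begin
      ((L *ᴹ M) *ᴹ N) i l                               ≡⟨ *ᴹ-entry (L *ᴹ M) N i l ⟩
      ∑[ k < n ] ((L *ᴹ M) i k * N k l)                 ≈⟨ sum-cong-≋ (λ k → *-congʳ (reflexive (*ᴹ-entry L M i k))) ⟩
      ∑[ k < n ] (∑[ j < n ] (L i j * M j k) * N k l)   ≈⟨ sum-cong-≋ (λ k → *-distribʳ-sum (N k l) (λ j → L i j * M j k)) ⟩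
      ∑[ k < n ] ∑[ j < n ] (L i j * M j k * N k l)     ≈⟨ ∑-comm (λ k j → L i j * M j k * N k l) ⟩
      ∑[ j < n ] ∑[ k < n ] (L i j * M j k * N k l)     ≈⟨ sum-cong-≋ (λ j → sum-cong-≋ (λ k → *-assoc (L i j) (M j k) (N k l))) ⟩
      ∑[ j < n ] ∑[ k < n ] (L i j * (M j k * N k l))   ≈⟨ sum-cong-≋ (λ j → sym (*-distribˡ-sum (L i j) (λ k → M j k * N k l))) ⟩
      ∑[ j < n ] (L i j * ∑[ k < n ] (M j k * N k l))   ≈⟨ sum-cong-≋ (λ j → *-congˡ (reflexive (≡.sym (*ᴹ-entry M N j l)))) ⟩
      ∑[ j < n ] (L i j * (M *ᴹ N) j l)                 ≡⟨ *ᴹ-entry L (M *ᴹ N) i l ⟨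
      (L *ᴹ (M *ᴹ N)) i l                               ∎

    *ᴹ-identityˡ : ∀ M → 1ᴹ *ᴹ M ≈ᴹ M
    *ᴹ-identityˡ M = entrywise λ i k → begin
      (1ᴹ *ᴹ M) i k                 ≡⟨ *ᴹ-entry 1ᴹ M i k ⟩
      ∑[ j < n ] (δ i j * M j k)    ≈⟨ sum-single i _ (λ j j≢i → trans (*-congʳ (reflexive (δ-off (j≢i ∘ ≡.sym)))) (zeroˡ _)) ⟩
      δ i i * M i k                 ≈⟨ trans (*-congʳ (reflexive (δ-diag i))) (*-identityˡ _) ⟩
      M i k                         ∎

    *ᴹ-identityʳ : ∀ M → M *ᴹ 1ᴹ ≈ᴹ M
    *ᴹ-identityʳ M = entrywise λ i k → begin
      (M *ᴹ 1ᴹ) i k                 ≡⟨ *ᴹ-entry M 1ᴹ i k ⟩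
      ∑[ j < n ] (M i j * δ j k)    ≈⟨ sum-single k _ (λ j j≢k → trans (*-congˡ (reflexive (δ-off j≢k))) (zeroʳ _)) ⟩
      M i k * δ k k                 ≈⟨ trans (*-congˡ (reflexive (δ-diag k))) (*-identityʳ _) ⟩
      M i k                         ∎

    *ᴹ-distribˡ : ∀ L M N → L *ᴹ (M +ᴹ N) ≈ᴹ L *ᴹ M +ᴹ L *ᴹ N
    *ᴹ-distribˡ L M N = entrywise λ i k → begin
      (L *ᴹ (M +ᴹ N)) i k                                   ≡⟨ *ᴹ-entry L (M +ᴹ N) i k ⟩
      ∑[ j < n ] (L i j * (M +ᴹ N) j k)                     ≈⟨ sum-cong-≋ (λ j → trans (*-congˡ (reflexive (+ᴹ-entry M N j k))) (distribˡ _ _ _)) ⟩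
      ∑[ j < n ] (L i j * M j k + L i j * N j k)            ≈⟨ ∑-distrib-+ (λ j → L i j * M j k) (λ j → L i j * N j k) ⟩
      ∑[ j < n ] (L i j * M j k) + ∑[ j < n ] (L i j * N j k) ≡⟨ ≡.cong₂ _+_ (*ᴹ-entry L M i k) (*ᴹ-entry L N i k) ⟨
      (L *ᴹ M) i k + (L *ᴹ N) i k                           ≡⟨ +ᴹ-entry (L *ᴹ M) (L *ᴹ N) i k ⟨
      (L *ᴹ M +ᴹ L *ᴹ N) i k                                ∎

    *ᴹ-distribʳ : ∀ L M N → (M +ᴹ N) *ᴹ L ≈ᴹ M *ᴹ L +ᴹ N *ᴹ L
    *ᴹ-distribʳ L M N = entrywise λ i k → begin
      ((M +ᴹ N) *ᴹ L) i k                                   ≡⟨ *ᴹ-entry (M +ᴹ N) L i k ⟩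
      ∑[ j < n ] ((M +ᴹ N) i j * L j k)                     ≈⟨ sum-cong-≋ (λ j → trans (*-congʳ (reflexive (+ᴹ-entry M N i j))) (distribʳ _ _ _)) ⟩
      ∑[ j < n ] (M i j * L j k + N i j * L j k)            ≈⟨ ∑-distrib-+ (λ j → M i j * L j k) (λ j → N i j * L j k) ⟩
      ∑[ j < n ] (M i j * L j k) + ∑[ j < n ] (N i j * L j k) ≡⟨ ≡.cong₂ _+_ (*ᴹ-entry M L i k) (*ᴹ-entry N L i k) ⟨
      (M *ᴹ L) i k + (N *ᴹ L) i k                           ≡⟨ +ᴹ-entry (M *ᴹ L) (N *ᴹ L) i k ⟨
      (M *ᴹ L +ᴹ N *ᴹ L) i k                                ∎

  matrixRing : Ring 0ℓ ℓ
  matrixRing = record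
    { Carrier = Matrix
    ; _≈_     = _≈ᴹ_
    ; _+_     = _+ᴹ_
    ; _*_     = _*ᴹ_
    ; -_      = -ᴹ_
    ; 0#      = 0ᴹ
    ; 1#      = 1ᴹ
    ; isRing  = record
      { +-isAbelianGroup = record
        { isGroup = record
          { isMonoid = record
            { isSemigroup = record
              { isMagma = record
                { isEquivalence = record
                  { refl  = entrywise λ i j → refl
                  ; sym   = λ M≈N → entrywise λ i j → sym (entry M≈N i j)
                  ; trans = λ L≈M M≈N → entrywise λ i j → trans (entry L≈M i j) (entry M≈N i j) }
                ; ∙-cong = λ {L} {M} {N} {O} L≈M N≈O → +ᴹ-pointwise λ i j →
                    trans (+-cong (entry L≈M i j) (entry N≈O i j)) (reflexive (≡.sym (+ᴹ-entry M O i j))) }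
              ; assoc = λ L M N → +ᴹ-pointwise λ i j → trans (+-congʳ (reflexive (+ᴹ-entry L M i j)))
                          (trans (+-assoc (L i j) (M i j) (N i j))
                                 (reflexive (≡.sym (≡.trans (+ᴹ-entry L (M +ᴹ N) i j) (≡.cong (λ x → L i j + x) (+ᴹ-entry M N i j)))))) }
            ; identity = (λ M → +ᴹ-pointwise λ i j → +-identityˡ (M i j))
                       , (λ M → +ᴹ-pointwise λ i j → +-identityʳ (M i j)) }
          ; inverse = (λ M → +ᴹ-pointwise λ i j → trans (+-congʳ (reflexive (-ᴹ-entry M i j))) (-‿inverseˡ (M i j)))
                    , (λ M → +ᴹ-pointwise λ i j → trans (+-congˡ (reflexive (-ᴹ-entry M i j))) (-‿inverseʳ (M i j)))
          ; ⁻¹-cong = λ {M} {N} M≈N → entrywise λ i j →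
              trans (reflexive (-ᴹ-entry M i j)) (trans (-‿cong (entry M≈N i j)) (reflexive (≡.sym (-ᴹ-entry N i j)))) }
        ; comm = λ M N → +ᴹ-pointwise λ i j → trans (+-comm (M i j) (N i j)) (reflexive (≡.sym (+ᴹ-entry N M i j))) }
      ; *-cong     = λ {L} {M} {N} {O} L≈M N≈O → entrywise λ i k → begin
          (L *ᴹ N) i k                ≡⟨ *ᴹ-entry L N i k ⟩
          ∑[ j < n ] (L i j * N j k)  ≈⟨ sum-cong-≋ (λ j → *-cong (entry L≈M i j) (entry N≈O j k)) ⟩
          ∑[ j < n ] (M i j * O j k)  ≡⟨ *ᴹ-entry M O i k ⟨
          (M *ᴹ O) i k                ∎
      ; *-assoc    = *ᴹ-assoc
      ; *-identity = *ᴹ-identityˡ , *ᴹ-identityʳ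
      ; distrib    = *ᴹ-distribˡ , *ᴹ-distribʳ
      }
    }

  •-pointwise : ∀ {a M N} → (∀ i j → a * M i j ≈ N i j) → a • M ≈ᴹ N
  •-pointwise {a} {M} e = entrywise λ i j → trans (reflexive (•-entry a M i j)) (e i j)

  •-cong : ∀ a {M N} → M ≈ᴹ N → a • M ≈ᴹ a • N
  •-cong a {M} {N} M≈N = •-pointwise λ i j → trans (*-congˡ (entry M≈N i j)) (reflexive (≡.sym (•-entry a N i j)))

  •-*ᴹˡ : ∀ a M N → (a • M) *ᴹ N ≈ᴹ a • (M *ᴹ N)
  •-*ᴹˡ a M N = entrywise λ i k → begin
    ((a • M) *ᴹ N) i k              ≡⟨ *ᴹ-entry (a • M) N i k ⟩
    ∑[ j < n ] ((a • M) i j * N j k) ≈⟨ sum-cong-≋ (λ j → trans (*-congʳ (reflexive (•-entry a M i j))) (*-assoc a (M i j) (N j k))) ⟩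
    ∑[ j < n ] (a * (M i j * N j k)) ≈⟨ *-distribˡ-sum a (λ j → M i j * N j k) ⟨
    a * ∑[ j < n ] (M i j * N j k)   ≡⟨ ≡.trans (•-entry a (M *ᴹ N) i k) (≡.cong (a *_) (*ᴹ-entry M N i k)) ⟨
    (a • (M *ᴹ N)) i k               ∎

  •-*ᴹʳ : ∀ a M N → M *ᴹ (a • N) ≈ᴹ a • (M *ᴹ N)
  •-*ᴹʳ a M N = entrywise λ i k → begin
    (M *ᴹ (a • N)) i k               ≡⟨ *ᴹ-entry M (a • N) i k ⟩
    ∑[ j < n ] (M i j * (a • N) j k) ≈⟨ sum-cong-≋ (λ j → trans (*-congˡ (reflexive (•-entry a N j k))) (x∙yz≈y∙xz (M i j) a (N j k))) ⟩
    ∑[ j < n ] (a * (M i j * N j k)) ≈⟨ *-distribˡ-sum a (λ j → M i j * N j k) ⟨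
    a * ∑[ j < n ] (M i j * N j k)   ≡⟨ ≡.trans (•-entry a (M *ᴹ N) i k) (≡.cong (a *_) (*ᴹ-entry M N i k)) ⟨
    (a • (M *ᴹ N)) i k               ∎
    where open import Algebra.Properties.CommutativeSemigroup *-commutativeSemigroup using (x∙yz≈y∙xz)

  •-distribˡ : ∀ a M N → a • (M +ᴹ N) ≈ᴹ a • M +ᴹ a • N
  •-distribˡ a M N = •-pointwise λ i j → trans (*-congˡ (reflexive (+ᴹ-entry M N i j)))
    (trans (distribˡ a _ _) (reflexive (≡.sym (≡.trans (+ᴹ-entry (a • M) (a • N) i j) (≡.cong₂ _+_ (•-entry a M i j) (•-entry a N i j))))))

  •-distribʳ : ∀ a b M → (a + b) • M ≈ᴹ a • M +ᴹ b • M
  •-distribʳ a b M = •-pointwise λ i j →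
    trans (distribʳ (M i j) a b) (reflexive (≡.sym (≡.trans (+ᴹ-entry (a • M) (b • M) i j) (≡.cong₂ _+_ (•-entry a M i j) (•-entry b M i j)))))

  •-assoc : ∀ a b M → (a * b) • M ≈ᴹ a • (b • M)
  •-assoc a b M = •-pointwise λ i j →
    trans (*-assoc a b (M i j)) (reflexive (≡.sym (≡.trans (•-entry a (b • M) i j) (≡.cong (a *_) (•-entry b M i j)))))

  •-zeroˡ : ∀ M → 0# • M ≈ᴹ 0ᴹ
  •-zeroˡ M = •-pointwise λ i j → zeroˡ (M i j)

  •-zeroʳ : ∀ a → a • 0ᴹ ≈ᴹ 0ᴹ
  •-zeroʳ a = •-pointwise λ i j → zeroʳ a

  •-identity : ∀ M → 1# • M ≈ᴹ M
  •-identity M = •-pointwise λ i j → *-identityˡ (M i j)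

  -•-identity : ∀ M → (- 1#) • M ≈ᴹ -ᴹ M
  -•-identity M = •-pointwise λ i j → trans (-1*x≈-x (M i j)) (reflexive (≡.sym (-ᴹ-entry M i j)))
    where open import Algebra.Properties.Ring ring using (-1*x≈-x)

  sumᴹ-entry : ∀ {k} (F : Fin k → Matrix) i j → RingSums.sum matrixRing F i j ≡ ∑[ l < k ] F l i j
  sumᴹ-entry {zero}  F i j = ≡.refl
  sumᴹ-entry {suc k} F i j =
    ≡.trans (+ᴹ-entry (F zero) _ i j) (≡.cong (λ x → F zero i j + x) (sumᴹ-entry (λ l → F (suc l)) i j))

ℤring : CommutativeRing 0ℓ 0ℓ
ℤring = ℤₚ.+-*-commutativeRing

module Σℤ = RingSums (CommutativeRing.ring ℤring)

private
  congMod : ∀ {m} x y {z} → z ≡ x ℤ.- y → + m ∣ₛ z → CongMod m x y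
  congMod x y ≡.refl m∣z = ∣⇒∣ᵤ m∣z

  divisor : ∀ {m} x y → CongMod m x y → + m ∣ₛ (x ℤ.- y)
  divisor x y = ∣ᵤ⇒∣

  sym-diff : ∀ x y → ℤ.- (x ℤ.- y) ≡ y ℤ.- x
  sym-diff = solve-∀
  trans-diff : ∀ x y z → (x ℤ.- y) ℤ.+ (y ℤ.- z) ≡ x ℤ.- z
  trans-diff = solve-∀
  +-diff : ∀ x y u v → (x ℤ.- y) ℤ.+ (u ℤ.- v) ≡ (x ℤ.+ u) ℤ.- (y ℤ.+ v)
  +-diff = solve-∀
  *-diff : ∀ x y u v → (x ℤ.- y) ℤ.* u ℤ.+ y ℤ.* (u ℤ.- v) ≡ x ℤ.* u ℤ.- y ℤ.* v
  *-diff = solve-∀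
  neg-diff : ∀ x y → ℤ.- (x ℤ.- y) ≡ ℤ.- x ℤ.- ℤ.- y
  neg-diff = solve-∀
  -0-diff : ∀ x → x ≡ x ℤ.- + 0
  -0-diff = solve-∀
  %-diff : ∀ r q d → (ℤ.- q) ℤ.* d ≡ r ℤ.- (r ℤ.+ q ℤ.* d)
  %-diff = solve-∀

infix 4 _≡_[mod_]
record _≡_[mod_] (x y : ℤ) (m : ℕ) : Set where
  constructor mod-intro
  field mod-elim : CongMod m x y
open _≡_[mod_] public

mod-reflexive : ∀ {m x y} → x ≡ y → x ≡ y [mod m ]
mod-reflexive {x = x} ≡.refl = mod-intro (congMod x x (≡.sym (ℤₚ.+-inverseʳ x)) (divides (+ 0) ≡.refl))

mod-sym : ∀ {m x y} → x ≡ y [mod m ] → y ≡ x [mod m ]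
mod-sym {x = x} {y} (mod-intro x∼y) = mod-intro (congMod y x (sym-diff x y) (∣m⇒∣-m (divisor x y x∼y)))

mod-trans : ∀ {m x y z} → x ≡ y [mod m ] → y ≡ z [mod m ] → x ≡ z [mod m ]
mod-trans {x = x} {y} {z} (mod-intro x∼y) (mod-intro y∼z) =
  mod-intro (congMod x z (trans-diff x y z) (∣m∣n⇒∣m+n (divisor x y x∼y) (divisor y z y∼z)))

mod-+ : ∀ {m x y u v} → x ≡ y [mod m ] → u ≡ v [mod m ] → x ℤ.+ u ≡ y ℤ.+ v [mod m ]
mod-+ {x = x} {y} {u} {v} (mod-intro x∼y) (mod-intro u∼v) =
  mod-intro (congMod (x ℤ.+ u) (y ℤ.+ v) (+-diff x y u v) (∣m∣n⇒∣m+n (divisor x y x∼y) (divisor u v u∼v)))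

mod-* : ∀ {m x y u v} → x ≡ y [mod m ] → u ≡ v [mod m ] → x ℤ.* u ≡ y ℤ.* v [mod m ]
mod-* {x = x} {y} {u} {v} (mod-intro x∼y) (mod-intro u∼v) = mod-intro (congMod (x ℤ.* u) (y ℤ.* v) (*-diff x y u v)
  (∣m∣n⇒∣m+n (∣m⇒∣m*n u (divisor x y x∼y)) (∣n⇒∣m*n y (divisor u v u∼v))))

mod-neg : ∀ {m x y} → x ≡ y [mod m ] → ℤ.- x ≡ ℤ.- y [mod m ]
mod-neg {x = x} {y} (mod-intro x∼y) = mod-intro (congMod (ℤ.- x) (ℤ.- y) (neg-diff x y) (∣m⇒∣-m (divisor x y x∼y)))

mod-*-zero : ∀ {a b x y} → x ≡ + 0 [mod a ] → y ≡ + 0 [mod b ] → x ℤ.* y ≡ + 0 [mod a ℕ.* b ]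
mod-*-zero {a} {b} {x} {y} (mod-intro x∼0) (mod-intro y∼0) = mod-intro (congMod (x ℤ.* y) (+ 0) (-0-diff (x ℤ.* y))
  (≡.subst (_∣ₛ x ℤ.* y) (≡.sym (ℤₚ.pos-* a b))
    (∣-trans (*-monoˡ-∣ (+ b) (≡.subst (+ a ∣ₛ_) (≡.sym (-0-diff x)) (divisor x (+ 0) x∼0)))
             (*-monoʳ-∣ x (≡.subst (+ b ∣ₛ_) (≡.sym (-0-diff y)) (divisor y (+ 0) y∼0))))))

mod-weakenʳ : ∀ {a b x y} → x ≡ y [mod a ℕ.* b ] → x ≡ y [mod b ]
mod-weakenʳ {a} {b} {x} {y} (mod-intro ab∣) = mod-intro (congMod x y ≡.refl
  (∣-trans (≡.subst (+ b ∣ₛ_) (≡.sym (ℤₚ.pos-* a b)) (∣n⇒∣m*n (+ a) ∣-refl)) (divisor x y ab∣)))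

mod-weakenˡ : ∀ {a b x y} → x ≡ y [mod a ℕ.* b ] → x ≡ y [mod a ]
mod-weakenˡ {a} {b} {x} {y} (mod-intro ab∣) = mod-intro (congMod x y ≡.refl
  (∣-trans (≡.subst (+ a ∣ₛ_) (≡.sym (ℤₚ.pos-* a b)) (∣m⇒∣m*n (+ b) ∣-refl)) (divisor x y ab∣)))

mod-one : ∀ x y → x ≡ y [mod 1 ]
mod-one x y = mod-intro (congMod x y ≡.refl (divides (x ℤ.- y) (≡.sym (ℤₚ.*-identityʳ _))))

mod-%ℕ : ∀ x d .{{_ : NonZero d}} → + (x %ℕ d) ≡ x [mod d ]
mod-%ℕ x d = mod-intro (congMod (+ (x %ℕ d)) x
  (≡.trans (%-diff (+ (x %ℕ d)) (x /ℕ d) (+ d)) (≡.cong (λ z → + (x %ℕ d) ℤ.- z) (≡.sym (a≡a%ℕn+[a/ℕn]*n x d))))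
  (divides (ℤ.- (x /ℕ d)) ≡.refl))

module _ {ℓ} (R : CommutativeRing 0ℓ ℓ) where
  open CommutativeRing R

  quotientRing : ∀ {ℓ′} {_∼_ : Rel Carrier ℓ′} → IsEquivalence _∼_ → _≈_ ⇒ _∼_ →
    Congruent₂ _∼_ _+_ → Congruent₂ _∼_ _*_ → Congruent₁ _∼_ (-_) → CommutativeRing 0ℓ ℓ′
  quotientRing {_∼_ = _∼_} isEquiv ≈⇒∼ +-cong∼ *-cong∼ -‿cong∼ = record
    { _≈_ = _∼_
    ; isCommutativeRing = record
      { isRing = record
        { +-isAbelianGroup = record
          { isGroup = record
            { isMonoid = record
              { isSemigroup = record
                { isMagma = record { isEquivalence = isEquiv ; ∙-cong = +-cong∼ }
                ; assoc   = λ x y z → ≈⇒∼ (+-assoc x y z)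
                }
              ; identity = (λ x → ≈⇒∼ (+-identityˡ x)) , (λ x → ≈⇒∼ (+-identityʳ x))
              }
            ; inverse = (λ x → ≈⇒∼ (-‿inverseˡ x)) , (λ x → ≈⇒∼ (-‿inverseʳ x))
            ; ⁻¹-cong = -‿cong∼
            }
          ; comm = λ x y → ≈⇒∼ (+-comm x y)
          }
        ; *-cong     = *-cong∼
        ; *-assoc    = λ x y z → ≈⇒∼ (*-assoc x y z)
        ; *-identity = (λ x → ≈⇒∼ (*-identityˡ x)) , (λ x → ≈⇒∼ (*-identityʳ x))
        ; distrib    = (λ x y z → ≈⇒∼ (distribˡ x y z)) , (λ x y z → ≈⇒∼ (distribʳ x y z))
        }
      ; *-comm = λ x y → ≈⇒∼ (*-comm x y)
      }
    }

ℤmod : ℕ → CommutativeRing 0ℓ 0ℓ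
ℤmod m = quotientRing ℤring {_∼_ = _≡_[mod m ]}
  (record { refl = mod-reflexive ≡.refl ; sym = mod-sym ; trans = mod-trans })
  mod-reflexive mod-+ mod-* mod-neg

-- Lifting inverses modulo p to ℤ_p

module NewtonStep {c ℓ} (S : Ring c ℓ) where
  open Ring S
  open import Algebra.Properties.Ring S using ([y-z]x≈yx-zx; x[y-z]≈xy-xz)
  open import Algebra.Properties.AbelianGroup +-abelianGroup using (⁻¹-∙-comm)
  open import Relation.Binary.Reasoning.Setoid setoid

  private
    sub-+ : ∀ x a b → x - (a + b) ≈ x - a - b
    sub-+ x a b = trans (+-congˡ (sym (⁻¹-∙-comm a b))) (sym (+-assoc x (- a) (- b)))

  newton-stepʳ : ∀ k r x → 1# - k * (x + r * (1# - k * x)) ≈ (1# - k * r) * (1# - k * x)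
  newton-stepʳ k r x = begin
    1# - k * (x + r * e)          ≈⟨ +-congˡ (-‿cong (trans (distribˡ k x _) (+-congˡ (sym (*-assoc k r e))))) ⟩
    1# - (k * x + k * r * e)      ≈⟨ sub-+ 1# _ _ ⟩
    e - k * r * e                 ≈⟨ +-congʳ (sym (*-identityˡ e)) ⟩
    1# * e - k * r * e            ≈⟨ sym ([y-z]x≈yx-zx e 1# (k * r)) ⟩
    (1# - k * r) * e              ∎
    where e = 1# - k * x

  newton-stepˡ : ∀ k r y → 1# - (y + (1# - y * k) * r) * k ≈ (1# - y * k) * (1# - r * k)
  newton-stepˡ k r y = begin
    1# - (y + e * r) * k          ≈⟨ +-congˡ (-‿cong (trans (distribʳ k y _) (+-congˡ (*-assoc e r k)))) ⟩
    1# - (y * k + e * (r * k))    ≈⟨ sub-+ 1# _ _ ⟩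
    e - e * (r * k)               ≈⟨ +-congʳ (sym (*-identityʳ e)) ⟩
    e * 1# - e * (r * k)          ≈⟨ sym (x[y-z]≈xy-xz e 1# (r * k)) ⟩
    e * (1# - r * k)              ∎
    where e = 1# - y * k

infix 4 _≡ᴹ_[mod_]
_≡ᴹ_[mod_] : ∀ {n} → Mat ℤ n → Mat ℤ n → ℕ → Set
M ≡ᴹ N [mod m ] = Matrices._≈ᴹ_ (ℤmod m) _ M N

module _ {n : ℕ} where
  open Matrices ℤring n using (_*ᴹ_; 0ᴹ; *ᴹ-entry)

  *ᴹ-divisible : ∀ {a b} {E F : Mat ℤ n} → E ≡ᴹ 0ᴹ [mod a ] → F ≡ᴹ 0ᴹ [mod b ] → E *ᴹ F ≡ᴹ 0ᴹ [mod a ℕ.* b ]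
  *ᴹ-divisible {a} {b} {E} {F} E≡0 F≡0 = Matrices.entrywise λ i k →
    ≡.subst (_≡ + 0 [mod a ℕ.* b ]) (≡.sym (*ᴹ-entry E F i k))
      (sum-zero (λ j → E i j ℤ.* F j k) (λ j → mod-*-zero (Matrices.entry E≡0 i j) (Matrices.entry F≡0 j k)))
    where open RingSums (CommutativeRing.ring (ℤmod (a ℕ.* b))) using (sum-zero)

-- Newton iteration: each step multiplies the residual 1 − K X by 1 − K R ≡ 0 (mod p).
module InverseLifting {n} (p : ℕ) (K R : Mat ℤ n)
  (KR≡1 : Matrices._*ᴹ_ ℤring n K R ≡ᴹ Matrices.1ᴹ ℤring n [mod p ])
  (RK≡1 : Matrices._*ᴹ_ ℤring n R K ≡ᴹ Matrices.1ᴹ ℤring n [mod p ]) where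
  private
    module Mod (m : ℕ) where
      open Ring (Matrices.matrixRing (ℤmod m) n) public
      open import Algebra.Properties.Group +-group public using (x∙y⁻¹≈ε⇒x≈y; x≈y⇒x∙y⁻¹≈ε)
      open NewtonStep (Matrices.matrixRing (ℤmod m) n) public
      open import Relation.Binary.Reasoning.Setoid setoid public

      residual : ∀ {X} → X ≡ᴹ 1# [mod m ] → 1# - X ≡ᴹ 0# [mod m ]
      residual X≈1 = x≈y⇒x∙y⁻¹≈ε (sym X≈1)

      from-residual : ∀ {X} → 1# - X ≡ᴹ 0# [mod m ] → X ≡ᴹ 1# [mod m ]
      from-residual {X} 1-X≈0 = sym (x∙y⁻¹≈ε⇒x≈y 1# X 1-X≈0)

  open Ring (Matrices.matrixRing ℤring n) using (_+_; _*_; _-_; 0#; 1#)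

  rightInverse : ℕ → Mat ℤ n
  rightInverse zero    = 0#
  rightInverse (suc k) = rightInverse k + R * (1# - K * rightInverse k)

  leftInverse : ℕ → Mat ℤ n
  leftInverse zero    = 0#
  leftInverse (suc k) = leftInverse k + (1# - leftInverse k * K) * R

  K*rightInverse : ∀ k → K * rightInverse k ≡ᴹ 1# [mod p ^ k ]
  K*rightInverse zero    = Matrices.entrywise λ i j → mod-one _ _
  K*rightInverse (suc k) = from-residual (begin
    1# - K * rightInverse (suc k)                   ≈⟨ newton-stepʳ K R (rightInverse k) ⟩
    (1# - K * R) * (1# - K * rightInverse k)        ≈⟨ *ᴹ-divisible (Mod.residual p KR≡1) (Mod.residual (p ^ k) (K*rightInverse k)) ⟩
    0#                                              ∎)
    where open Mod (p ^ suc k) using (from-residual; begin_; step-≈-⟩; _∎; newton-stepʳ)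

  leftInverse*K : ∀ k → leftInverse k * K ≡ᴹ 1# [mod p ^ k ]
  leftInverse*K zero    = Matrices.entrywise λ i j → mod-one _ _
  leftInverse*K (suc k) = from-residual (begin
    1# - leftInverse (suc k) * K                    ≈⟨ newton-stepˡ K R (leftInverse k) ⟩
    (1# - leftInverse k * K) * (1# - R * K)         ≈⟨ ≡.subst (λ q → (1# - leftInverse k * K) * (1# - R * K) ≡ᴹ 0# [mod q ]) (ℕₚ.*-comm (p ^ k) p)
                                                         (*ᴹ-divisible (Mod.residual (p ^ k) (leftInverse*K k)) (Mod.residual p RK≡1)) ⟩
    0#                                              ∎)
    where open Mod (p ^ suc k) using (from-residual; begin_; step-≈-⟩; _∎; newton-stepˡ)

  rightInverse-step : ∀ k → rightInverse (suc k) ≡ᴹ rightInverse k [mod p ^ k ]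
  rightInverse-step k = begin
    X + R * (1# - K * X)    ≈⟨ +-congˡ (*-congˡ (residual (K*rightInverse k))) ⟩
    X + R * 0#              ≈⟨ +-congˡ (zeroʳ R) ⟩
    X + 0#                  ≈⟨ +-identityʳ X ⟩
    X                       ∎
    where
    X = rightInverse k
    open Mod (p ^ k) using (begin_; step-≈-⟩; _∎; +-congˡ; *-congˡ; zeroʳ; +-identityʳ; residual)

  rightInverse*K : ∀ k → rightInverse k * K ≡ᴹ 1# [mod p ^ k ]
  rightInverse*K k = begin
    X * K                ≈⟨ *-congʳ (sym (*-identityˡ X)) ⟩
    1# * X * K           ≈⟨ *-congʳ (*-congʳ (sym (leftInverse*K k))) ⟩
    Y * K * X * K        ≈⟨ *-congʳ (*-assoc Y K X) ⟩
    Y * (K * X) * K      ≈⟨ *-congʳ (*-congˡ (K*rightInverse k)) ⟩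
    Y * 1# * K           ≈⟨ *-congʳ (*-identityʳ Y) ⟩
    Y * K                ≈⟨ leftInverse*K k ⟩
    1#                   ∎
    where
    X = rightInverse k
    Y = leftInverse k
    open Mod (p ^ k) using (begin_; step-≈-⟩; _∎; sym; *-congˡ; *-congʳ; *-assoc; *-identityˡ; *-identityʳ)

module _ (p : ℕ) .{{_ : NonZero p}} where

  padicLimit : (x : ℕ → ℤ) → (∀ k → x (suc k) ≡ x k [mod p ^ k ]) → ℤ[ p ]
  padicLimit x coherent = record
    { digit  = λ k → _%ℕ_ (x k) (p ^ k) {{ℕₚ.m^n≢0 p k}}
    ; bound  = λ k → n%ℕd<d (x k) (p ^ k) {{ℕₚ.m^n≢0 p k}}
    ; compat = λ k → mod-elim (mod-trans (mod-weakenʳ {p} (mod-%ℕ (x (suc k)) (p ^ suc k) {{ℕₚ.m^n≢0 p (suc k)}}))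
                                         (mod-trans (coherent k) (mod-sym (mod-%ℕ (x k) (p ^ k) {{ℕₚ.m^n≢0 p k}}))))
    }

  padicLimit-digit : ∀ x coherent k → + digit (padicLimit x coherent) k ≡ x k [mod p ^ k ]
  padicLimit-digit x _ k = mod-%ℕ (x k) (p ^ k) {{ℕₚ.m^n≢0 p k}}

  padicMatrix : ∀ {n} (X : ℕ → Mat ℤ n) → (∀ k → X (suc k) ≡ᴹ X k [mod p ^ k ]) → Mat ℤ[ p ] n
  padicMatrix X coherent i j = padicLimit (λ k → X k i j) (λ k → Matrices.entry (coherent k) i j)

  level-padicMatrix : ∀ {n} (X : ℕ → Mat ℤ n) coherent k → level (padicMatrix X coherent) k ≡ᴹ X k [mod p ^ k ]
  level-padicMatrix X coherent k =
    Matrices.entrywise λ i j → padicLimit-digit (λ k → X k i j) (λ k → Matrices.entry (coherent k) i j) k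

-- The Cayley–Hamilton theorem

module Evaluation {n} (A : Mat ℤ n) where
  open Matrices ℤring n
  open Ring matrixRing
    using (setoid; +-cong; +-congˡ; +-congʳ; +-identityˡ; +-identityʳ;
           *-congˡ; *-congʳ; *-assoc; *-identityˡ; *-identityʳ; distribˡ; distribʳ; zeroˡ; zeroʳ; rawRing; isRing)
    renaming (refl to ≈ᴹ-refl; sym to ≈ᴹ-sym; trans to ≈ᴹ-trans)
  open import Algebra.Properties.CommutativeSemigroup (Ring.+-commutativeSemigroup matrixRing) using (interchange)
  open import Relation.Binary.Reasoning.Setoid setoid

  eval : Poly → Matrix
  eval []      = 0ᴹ
  eval (a ∷ p) = a • 1ᴹ +ᴹ A *ᴹ eval p

  scalar-*ᴹ : ∀ a M → a • 1ᴹ *ᴹ M ≈ᴹ a • M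
  scalar-*ᴹ a M = ≈ᴹ-trans (•-*ᴹˡ a 1ᴹ M) (•-cong a (*-identityˡ M))

  *ᴹ-scalar : ∀ a M → M *ᴹ a • 1ᴹ ≈ᴹ a • M
  *ᴹ-scalar a M = ≈ᴹ-trans (•-*ᴹʳ a M 1ᴹ) (•-cong a (*-identityʳ M))

  eval-+ₚ : ∀ p q → eval (p +ₚ q) ≈ᴹ eval p +ᴹ eval q
  eval-+ₚ []      q       = ≈ᴹ-sym (+-identityˡ (eval q))
  eval-+ₚ (a ∷ p) []      = ≈ᴹ-sym (+-identityʳ (eval (a ∷ p)))
  eval-+ₚ (a ∷ p) (b ∷ q) = begin
    (a ℤ.+ b) • 1ᴹ +ᴹ A *ᴹ eval (p +ₚ q)
      ≈⟨ +-cong (•-distribʳ a b 1ᴹ) (≈ᴹ-trans (*-congˡ (eval-+ₚ p q)) (distribˡ A _ _)) ⟩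
    (a • 1ᴹ +ᴹ b • 1ᴹ) +ᴹ (A *ᴹ eval p +ᴹ A *ᴹ eval q)
      ≈⟨ interchange _ _ _ _ ⟩
    eval (a ∷ p) +ᴹ eval (b ∷ q) ∎

  eval-scaleₚ : ∀ c p → eval (scaleₚ c p) ≈ᴹ c • eval p
  eval-scaleₚ c []      = ≈ᴹ-sym (•-zeroʳ c)
  eval-scaleₚ c (a ∷ p) = begin
    (c ℤ.* a) • 1ᴹ +ᴹ A *ᴹ eval (scaleₚ c p)
      ≈⟨ +-cong (•-assoc c a 1ᴹ) (≈ᴹ-trans (*-congˡ (eval-scaleₚ c p)) (•-*ᴹʳ c A _)) ⟩
    c • (a • 1ᴹ) +ᴹ c • (A *ᴹ eval p)
      ≈⟨ ≈ᴹ-sym (•-distribˡ c _ _) ⟩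
    c • eval (a ∷ p) ∎

  eval-*ₚ : ∀ p q → eval (p *ₚ q) ≈ᴹ eval p *ᴹ eval q
  eval-*ₚ []      q = ≈ᴹ-sym (zeroˡ (eval q))
  eval-*ₚ (a ∷ p) q = begin
    eval (scaleₚ a q +ₚ (+ 0 ∷ p *ₚ q))
      ≈⟨ eval-+ₚ (scaleₚ a q) _ ⟩
    eval (scaleₚ a q) +ᴹ ((+ 0) • 1ᴹ +ᴹ A *ᴹ eval (p *ₚ q))
      ≈⟨ +-cong (eval-scaleₚ a q) (≈ᴹ-trans (+-congʳ (•-zeroˡ 1ᴹ)) (≈ᴹ-trans (+-identityˡ _) (*-congˡ (eval-*ₚ p q)))) ⟩
    a • eval q +ᴹ A *ᴹ (eval p *ᴹ eval q)
      ≈⟨ ≈ᴹ-sym (+-cong (scalar-*ᴹ a (eval q)) (*-assoc A _ _)) ⟩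
    a • 1ᴹ *ᴹ eval q +ᴹ A *ᴹ eval p *ᴹ eval q
      ≈⟨ ≈ᴹ-sym (distribʳ _ _ _) ⟩
    eval (a ∷ p) *ᴹ eval q ∎

  A-commutes-eval : ∀ p → A *ᴹ eval p ≈ᴹ eval p *ᴹ A
  A-commutes-eval []      = ≈ᴹ-trans (zeroʳ A) (≈ᴹ-sym (zeroˡ A))
  A-commutes-eval (a ∷ p) = begin
    A *ᴹ (a • 1ᴹ +ᴹ A *ᴹ eval p)           ≈⟨ distribˡ A _ _ ⟩
    A *ᴹ a • 1ᴹ +ᴹ A *ᴹ (A *ᴹ eval p)      ≈⟨ +-cong (≈ᴹ-trans (*ᴹ-scalar a A) (≈ᴹ-sym (scalar-*ᴹ a A))) (*-congˡ (A-commutes-eval p)) ⟩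
    a • 1ᴹ *ᴹ A +ᴹ A *ᴹ (eval p *ᴹ A)      ≈⟨ +-congˡ (≈ᴹ-sym (*-assoc A _ A)) ⟩
    a • 1ᴹ *ᴹ A +ᴹ A *ᴹ eval p *ᴹ A        ≈⟨ ≈ᴹ-sym (distribʳ A _ _) ⟩
    eval (a ∷ p) *ᴹ A                       ∎

  eval-commutes : ∀ p q → eval p *ᴹ eval q ≈ᴹ eval q *ᴹ eval p
  eval-commutes []      q = ≈ᴹ-trans (zeroˡ (eval q)) (≈ᴹ-sym (zeroʳ (eval q)))
  eval-commutes (a ∷ p) q = begin
    (a • 1ᴹ +ᴹ A *ᴹ eval p) *ᴹ eval q          ≈⟨ distribʳ _ _ _ ⟩
    a • 1ᴹ *ᴹ eval q +ᴹ A *ᴹ eval p *ᴹ eval q  ≈⟨ +-cong (≈ᴹ-trans (scalar-*ᴹ a _) (≈ᴹ-sym (*ᴹ-scalar a _))) (*-assoc A _ _) ⟩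
    eval q *ᴹ a • 1ᴹ +ᴹ A *ᴹ (eval p *ᴹ eval q) ≈⟨ +-congˡ (*-congˡ (eval-commutes p q)) ⟩
    eval q *ᴹ a • 1ᴹ +ᴹ A *ᴹ (eval q *ᴹ eval p) ≈⟨ +-congˡ (≈ᴹ-sym (*-assoc A _ _)) ⟩
    eval q *ᴹ a • 1ᴹ +ᴹ A *ᴹ eval q *ᴹ eval p  ≈⟨ +-congˡ (*-congʳ (A-commutes-eval q)) ⟩
    eval q *ᴹ a • 1ᴹ +ᴹ eval q *ᴹ A *ᴹ eval p  ≈⟨ +-congˡ (*-assoc _ A _) ⟩
    eval q *ᴹ a • 1ᴹ +ᴹ eval q *ᴹ (A *ᴹ eval p) ≈⟨ ≈ᴹ-sym (distribˡ _ _ _) ⟩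
    eval q *ᴹ eval (a ∷ p)                      ∎

  negₚ : Poly → Poly
  negₚ = scaleₚ (ℤ.- + 1)

  oneₚ : Poly
  oneₚ = + 1 ∷ []

  eval-oneₚ : eval oneₚ ≈ᴹ 1ᴹ
  eval-oneₚ = ≈ᴹ-trans (+-congˡ (zeroʳ A)) (≈ᴹ-trans (+-identityʳ _) (•-identity 1ᴹ))

  -- Integer polynomials, identified when they take the same value at A. The determinant
  -- identities hold in this commutative ring, and the entries of xI − A take the values
  -- −Aᵢⱼ + δᵢⱼ A there: this is where the adjugate proof of Cayley–Hamilton happens.
  evaluationRawRing : RawRing 0ℓ 0ℓ
  evaluationRawRing = record
    { Carrier = Poly ; _≈_ = λ p q → eval p ≈ᴹ eval q
    ; _+_ = _+ₚ_ ; _*_ = _*ₚ_ ; -_ = negₚ ; 0# = [] ; 1# = oneₚ }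

  eval-isRingMonomorphism : IsRingMonomorphism evaluationRawRing rawRing eval
  eval-isRingMonomorphism = record
    { isRingHomomorphism = record
      { isSemiringHomomorphism = record
        { isNearSemiringHomomorphism = record
          { +-isMonoidHomomorphism = record
            { isMagmaHomomorphism = record
              { isRelHomomorphism = record { cong = id }
              ; homo = eval-+ₚ }
            ; ε-homo = ≈ᴹ-refl }
          ; *-homo = eval-*ₚ }
        ; 1#-homo = eval-oneₚ }
      ; -‿homo = λ p → ≈ᴹ-trans (eval-scaleₚ _ p) (-•-identity (eval p)) }
    ; injective = id }

  evaluationRing : CommutativeRing 0ℓ 0ℓ
  evaluationRing = record
    { isCommutativeRing = record
      { isRing = RingMonomorphism.isRing eval-isRingMonomorphism isRing
      ; *-comm = λ p q → ≈ᴹ-trans (eval-*ₚ p q) (≈ᴹ-trans (eval-commutes p q) (≈ᴹ-sym (eval-*ₚ q p))) } }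

signℤ-suc : ∀ k → signℤ (suc k) ≡ ℤ.- signℤ k
signℤ-suc zero          = ≡.refl
signℤ-suc (suc zero)    = ≡.refl
signℤ-suc (suc (suc k)) = signℤ-suc k

column-cancellation : ∀ {n} (A : Mat ℤ n) j r →
  Σℤ.sum (λ i → ℤ.- A i j ℤ.* Matrices.δ ℤring n r i ℤ.+ Matrices.δ ℤring n i j ℤ.* A r i) ≡ + 0
column-cancellation {n} A j r = begin
  Σℤ.sum (λ i → ℤ.- A i j ℤ.* δ r i ℤ.+ δ i j ℤ.* A r i)
    ≡⟨ Σℤ.∑-distrib-+ (λ i → ℤ.- A i j ℤ.* δ r i) (λ i → δ i j ℤ.* A r i) ⟩
  Σℤ.sum (λ i → ℤ.- A i j ℤ.* δ r i) ℤ.+ Σℤ.sum (λ i → δ i j ℤ.* A r i)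
    ≡⟨ ≡.cong₂ ℤ._+_ (Σℤ.sum-single r _ (λ i i≢r → ≡.trans (≡.cong (ℤ.- A i j ℤ.*_) (δ-off (i≢r ∘ ≡.sym))) (ℤₚ.*-zeroʳ (ℤ.- A i j))))
                      (Σℤ.sum-single j _ (λ i i≢j → ≡.trans (≡.cong (ℤ._* A r i) (δ-off i≢j)) (ℤₚ.*-zeroˡ (A r i)))) ⟩
  ℤ.- A r j ℤ.* δ r r ℤ.+ δ j j ℤ.* A r j
    ≡⟨ ≡.cong₂ (λ x y → ℤ.- A r j ℤ.* x ℤ.+ y ℤ.* A r j) (δ-diag r) (δ-diag j) ⟩
  ℤ.- A r j ℤ.* + 1 ℤ.+ + 1 ℤ.* A r j
    ≡⟨ ≡.cong₂ ℤ._+_ (ℤₚ.*-identityʳ (ℤ.- A r j)) (ℤₚ.*-identityˡ (A r j)) ⟩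
  ℤ.- A r j ℤ.+ A r j
    ≡⟨ ℤₚ.+-inverseˡ (A r j) ⟩
  + 0 ∎
  where
  open Matrices ℤring n using (δ; δ-diag; δ-off)
  open ≡.≡-Reasoning

module CayleyHamilton {m} (A : Mat ℤ (suc m)) where
  open Evaluation A
  open Matrices ℤring (suc m)
  open Ring matrixRing
    using (setoid; +-congˡ; *-congˡ; *-congʳ; *-assoc; zeroˡ; zeroʳ; +-identityʳ)
    renaming (refl to ≈ᴹ-refl; sym to ≈ᴹ-sym; trans to ≈ᴹ-trans)
  open import Relation.Binary.Reasoning.Setoid setoid
  module Σᴹ = RingSums matrixRing
  module Σₑ = RingSums (CommutativeRing.ring evaluationRing)
  module Ev = Determinant evaluationRing

  sumₚ≡sum : ∀ {k} (f : Fin k → Poly) → sumₚ f ≡ Σₑ.sum f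
  sumₚ≡sum {zero}  f = ≡.refl
  sumₚ≡sum {suc k} f = ≡.cong (f zero +ₚ_) (sumₚ≡sum (λ j → f (suc j)))

  eval-sum : ∀ {k} (f : Fin k → Poly) → eval (Σₑ.sum f) ≈ᴹ Σᴹ.sum (λ i → eval (f i))
  eval-sum {zero}  f = ≈ᴹ-refl
  eval-sum {suc k} f = ≈ᴹ-trans (eval-+ₚ (f zero) _) (+-congˡ (eval-sum (λ j → f (suc j))))

  eval-sign : ∀ k → eval (Ev.sign k) ≈ᴹ signℤ k • 1ᴹ
  eval-sign zero    = ≈ᴹ-trans eval-oneₚ (≈ᴹ-sym (•-identity 1ᴹ))
  eval-sign (suc k) = begin
    eval (negₚ (Ev.sign k))          ≈⟨ eval-scaleₚ _ (Ev.sign k) ⟩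
    (ℤ.- + 1) • eval (Ev.sign k)     ≈⟨ •-cong _ (eval-sign k) ⟩
    (ℤ.- + 1) • signℤ k • 1ᴹ         ≈⟨ •-assoc _ _ 1ᴹ ⟨
    (ℤ.- + 1 ℤ.* signℤ k) • 1ᴹ       ≡⟨ ≡.cong (_• 1ᴹ) (≡.trans (ℤₚ.-1*i≡-i (signℤ k)) (≡.sym (signℤ-suc k))) ⟩
    signℤ (suc k) • 1ᴹ               ∎

  detₚ≈det : ∀ k (M : Mat Poly k) → eval (detₚ k M) ≈ᴹ eval (Ev.det k M)
  detₚ≈det zero    M = ≈ᴹ-refl
  detₚ≈det (suc k) M = begin
    eval (sumₚ termₚ)                          ≡⟨ ≡.cong eval (sumₚ≡sum termₚ) ⟩
    eval (Σₑ.sum termₚ)                        ≈⟨ Σₑ.sum-cong-≋ {suc k} {termₚ} {termₛ} same-term ⟩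
    eval (Ev.det (suc k) M)                    ∎
    where
    d = λ j → detₚ k (Ev.minor M zero j)
    termₚ = λ j → scaleₚ (signℤ (toℕ j)) (M zero j *ₚ d j)
    termₛ = λ j → M zero j *ₚ (Ev.sign (toℕ j) *ₚ Ev.det k (Ev.minor M zero j))
    same-term : ∀ j → eval (termₚ j) ≈ᴹ eval (termₛ j)
    same-term j = begin
      eval (scaleₚ s (M zero j *ₚ d j))              ≈⟨ eval-scaleₚ s (M zero j *ₚ d j) ⟩
      s • eval (M zero j *ₚ d j)                     ≈⟨ •-cong s (eval-*ₚ (M zero j) (d j)) ⟩
      s • (eval (M zero j) *ᴹ eval (d j))            ≈⟨ •-*ᴹʳ s (eval (M zero j)) (eval (d j)) ⟨
      eval (M zero j) *ᴹ s • eval (d j)              ≈⟨ *-congˡ (•-cong s (detₚ≈det k (Ev.minor M zero j))) ⟩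
      eval (M zero j) *ᴹ s • eval D                   ≈⟨ *-congˡ (scalar-*ᴹ s (eval D)) ⟨
      eval (M zero j) *ᴹ (s • 1ᴹ *ᴹ eval D)           ≈⟨ *-congˡ (*-congʳ (eval-sign (toℕ j))) ⟨
      eval (M zero j) *ᴹ (eval (Ev.sign (toℕ j)) *ᴹ eval D) ≈⟨ *-congˡ (eval-*ₚ (Ev.sign (toℕ j)) D) ⟨
      eval (M zero j) *ᴹ eval (Ev.sign (toℕ j) *ₚ D)          ≈⟨ eval-*ₚ (M zero j) (Ev.sign (toℕ j) *ₚ D) ⟨
      eval (M zero j *ₚ (Ev.sign (toℕ j) *ₚ Ev.det k (Ev.minor M zero j))) ∎
      where
      s = signℤ (toℕ j)
      D = Ev.det k (Ev.minor M zero j)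

  charMatrix : Mat Poly (suc m)
  charMatrix i j = (ℤ.- A i j) ∷ δ i j ∷ []

  rowOfOnes : Fin (suc m) → Matrix
  rowOfOnes k r c = δ r k

  *ᴹ-rowOfOnes : ∀ X k r c → (X *ᴹ rowOfOnes k) r c ≡ X r k
  *ᴹ-rowOfOnes X k r c = ≡.trans (*ᴹ-entry X (rowOfOnes k) r c) (≡.trans
    (Σℤ.sum-single k (λ j → X r j ℤ.* δ j k) (λ j j≢k → ≡.trans (≡.cong (X r j ℤ.*_) (δ-off j≢k)) (ℤₚ.*-zeroʳ (X r j))))
    (≡.trans (≡.cong (X r k ℤ.*_) (δ-diag k)) (ℤₚ.*-identityʳ (X r k))))

  eval-linear : ∀ a b r c → eval (a ∷ b ∷ []) r c ≡ a ℤ.* δ r c ℤ.+ b ℤ.* A r c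
  eval-linear a b r c = ≡.trans (≡.trans (+ᴹ-entry (a • 1ᴹ) (A *ᴹ eval (b ∷ [])) r c)
                                         (≡.cong (λ x → x ℤ.+ (A *ᴹ eval (b ∷ [])) r c) (•-entry a 1ᴹ r c)))
                                (≡.cong (λ x → a ℤ.* δ r c ℤ.+ x) (≡.trans (entry A*b≈b•A r c) (•-entry b A r c)))
    where
    A*b≈b•A : A *ᴹ eval (b ∷ []) ≈ᴹ b • A
    A*b≈b•A = ≈ᴹ-trans (*-congˡ (≈ᴹ-trans (+-congˡ (zeroʳ A)) (+-identityʳ _))) (*ᴹ-scalar b A)

  charMatrix-columns-vanish : ∀ j → Σᴹ.sum (λ i → eval (charMatrix i j) *ᴹ rowOfOnes i) ≈ᴹ 0ᴹ
  charMatrix-columns-vanish j = entrywise λ r c →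
    ≡.trans (sumᴹ-entry (λ i → eval (charMatrix i j) *ᴹ rowOfOnes i) r c)
   (≡.trans (Σℤ.sum-cong-≗ (λ i → ≡.trans (*ᴹ-rowOfOnes (eval (charMatrix i j)) i r c) (eval-linear _ _ r i)))
            (column-cancellation A j r))

  det-charMatrix-annihilates : ∀ k → eval (Ev.det (suc m) charMatrix) *ᴹ rowOfOnes k ≈ᴹ 0ᴹ
  det-charMatrix-annihilates k = begin
    eval (Ev.det _ B) *ᴹ U k
      ≈⟨ *-congʳ (Ev.det-expand-row B k) ⟩
    eval (T k) *ᴹ U k
      ≈⟨ Σᴹ.sum-single k (λ i → eval (T i) *ᴹ U i)
           (λ i i≢k → ≈ᴹ-trans (*-congʳ (Ev.alien-cofactor-expansion B i≢k)) (zeroˡ (U i))) ⟨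
    Σᴹ.sum (λ i → eval (T i) *ᴹ U i)
      ≈⟨ Σᴹ.sum-cong-≋ expand ⟩
    Σᴹ.sum (λ i → Σᴹ.sum (λ j → E j *ᴹ (eval (B i j) *ᴹ U i)))
      ≈⟨ Σᴹ.∑-comm (λ i j → E j *ᴹ (eval (B i j) *ᴹ U i)) ⟩
    Σᴹ.sum (λ j → Σᴹ.sum (λ i → E j *ᴹ (eval (B i j) *ᴹ U i)))
      ≈⟨ Σᴹ.sum-cong-≋ (λ j → Σᴹ.*-distribˡ-sum (E j) (λ i → eval (B i j) *ᴹ U i)) ⟨
    Σᴹ.sum (λ j → E j *ᴹ Σᴹ.sum (λ i → eval (B i j) *ᴹ U i))
      ≈⟨ Σᴹ.sum-zero _ (λ j → ≈ᴹ-trans (*-congˡ (charMatrix-columns-vanish j)) (zeroʳ (E j))) ⟩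
    0ᴹ ∎
    where
    B = charMatrix
    U = rowOfOnes
    E = λ j → eval (Ev.cofactor B k j)
    T = λ i → Σₑ.sum (λ j → B i j *ₚ Ev.cofactor B k j)
    expand : ∀ i → eval (T i) *ᴹ U i ≈ᴹ Σᴹ.sum (λ j → E j *ᴹ (eval (B i j) *ᴹ U i))
    expand i = begin
      eval (T i) *ᴹ U i                                      ≈⟨ *-congʳ (eval-sum (λ j → B i j *ₚ Ev.cofactor B k j)) ⟩
      Σᴹ.sum (λ j → eval (B i j *ₚ Ev.cofactor B k j)) *ᴹ U i ≈⟨ Σᴹ.*-distribʳ-sum (U i) (λ j → eval (B i j *ₚ Ev.cofactor B k j)) ⟩
      Σᴹ.sum (λ j → eval (B i j *ₚ Ev.cofactor B k j) *ᴹ U i) ≈⟨ Σᴹ.sum-cong-≋ (λ j → ≈ᴹ-trans (*-congʳ (≈ᴹ-trans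
                                                                  (eval-*ₚ (B i j) (Ev.cofactor B k j)) (eval-commutes (B i j) (Ev.cofactor B k j))))
                                                                  (*-assoc (E j) (eval (B i j)) (U i))) ⟩
      Σᴹ.sum (λ j → E j *ᴹ (eval (B i j) *ᴹ U i))            ∎

  cayleyHamilton : eval (charPoly A) ≈ᴹ 0ᴹ
  cayleyHamilton = entrywise λ r c → ≡.trans (entry (detₚ≈det (suc m) charMatrix) r c)
    (≡.trans (≡.sym (*ᴹ-rowOfOnes (eval (Ev.det (suc m) charMatrix)) c r c)) (entry (det-charMatrix-annihilates c) r c))

-- The characteristic polynomial is monic of degree n

coeff-+ₚ : ∀ p q k → coeff (p +ₚ q) k ≡ coeff p k ℤ.+ coeff q k
coeff-+ₚ []      q       k       = ≡.sym (ℤₚ.+-identityˡ _)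
coeff-+ₚ (a ∷ p) []      k       = ≡.sym (ℤₚ.+-identityʳ _)
coeff-+ₚ (a ∷ p) (b ∷ q) zero    = ≡.refl
coeff-+ₚ (a ∷ p) (b ∷ q) (suc k) = coeff-+ₚ p q k

coeff-scaleₚ : ∀ c p k → coeff (scaleₚ c p) k ≡ c ℤ.* coeff p k
coeff-scaleₚ c []      k       = ≡.sym (ℤₚ.*-zeroʳ c)
coeff-scaleₚ c (a ∷ p) zero    = ≡.refl
coeff-scaleₚ c (a ∷ p) (suc k) = coeff-scaleₚ c p k

coeff-sumₚ : ∀ {m} (f : Fin m → Poly) k → coeff (sumₚ f) k ≡ Σℤ.sum (λ j → coeff (f j) k)
coeff-sumₚ {zero}  f k = ≡.refl
coeff-sumₚ {suc m} f k =
  ≡.trans (coeff-+ₚ (f zero) _ k) (≡.cong (λ x → coeff (f zero) k ℤ.+ x) (coeff-sumₚ (λ j → f (suc j)) k))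

linearMatrix : ∀ {m} → Mat ℤ m → Mat ℤ m → Mat Poly m
linearMatrix a b i j = a i j ∷ b i j ∷ []

coeff-linear-*ₚ : ∀ a b q k → coeff ((a ∷ b ∷ []) *ₚ q) (suc k) ≡ a ℤ.* coeff q (suc k) ℤ.+ b ℤ.* coeff q k
coeff-linear-*ₚ a b q k = begin
  coeff (scaleₚ a q +ₚ (+ 0 ∷ (scaleₚ b q +ₚ (+ 0 ∷ [])))) (suc k)
    ≡⟨ coeff-+ₚ (scaleₚ a q) _ (suc k) ⟩
  coeff (scaleₚ a q) (suc k) ℤ.+ coeff (scaleₚ b q +ₚ (+ 0 ∷ [])) k
    ≡⟨ ≡.cong₂ ℤ._+_ (coeff-scaleₚ a q (suc k)) (≡.trans (coeff-+ₚ (scaleₚ b q) _ k) (≡.cong₂ ℤ._+_ (coeff-scaleₚ b q k) (coeff-0 k))) ⟩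
  a ℤ.* coeff q (suc k) ℤ.+ (b ℤ.* coeff q k ℤ.+ + 0)
    ≡⟨ ≡.cong (λ x → a ℤ.* coeff q (suc k) ℤ.+ x) (ℤₚ.+-identityʳ _) ⟩
  a ℤ.* coeff q (suc k) ℤ.+ b ℤ.* coeff q k ∎
  where
  open ≡.≡-Reasoning
  coeff-0 : ∀ k → coeff (+ 0 ∷ []) k ≡ + 0
  coeff-0 zero    = ≡.refl
  coeff-0 (suc k) = ≡.refl

module _ {m} (a b : Mat ℤ (suc m)) where

  private
    D : Fin (suc m) → Poly
    D j = detₚ m (linearMatrix (λ r c → a (suc r) (punchIn j c)) (λ r c → b (suc r) (punchIn j c)))

  coeff-detₚ-linear : ∀ d → coeff (detₚ (suc m) (linearMatrix a b)) (suc d) ≡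
    Σℤ.sum (λ j → signℤ (toℕ j) ℤ.* (a zero j ℤ.* coeff (D j) (suc d) ℤ.+ b zero j ℤ.* coeff (D j) d))
  coeff-detₚ-linear d = ≡.trans (coeff-sumₚ (λ j → scaleₚ (signℤ (toℕ j)) ((a zero j ∷ b zero j ∷ []) *ₚ D j)) (suc d)) (Σℤ.sum-cong-≗ λ j →
    ≡.trans (coeff-scaleₚ (signℤ (toℕ j)) ((a zero j ∷ b zero j ∷ []) *ₚ D j) (suc d)) (≡.cong (signℤ (toℕ j) ℤ.*_) (coeff-linear-*ₚ (a zero j) (b zero j) (D j) d)))

detₚ-linear-degree : ∀ m (a b : Mat ℤ m) k → coeff (detₚ m (linearMatrix a b)) (m ℕ.+ suc k) ≡ + 0
detₚ-linear-degree zero    a b k = ≡.refl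
detₚ-linear-degree (suc m) a b k = ≡.trans (coeff-detₚ-linear a b (m ℕ.+ suc k)) (Σℤ.sum-zero _ λ j →
  ≡.trans (≡.cong₂ (λ x y → signℤ (toℕ j) ℤ.* (a zero j ℤ.* x ℤ.+ b zero j ℤ.* y))
             (≡.trans (≡.cong (coeff (D j)) (≡.sym (ℕₚ.+-suc m (suc k)))) (detₚ-linear-degree m (a′ j) (b′ j) (suc k)))
             (detₚ-linear-degree m (a′ j) (b′ j) k))
          (≡.trans (≡.cong (signℤ (toℕ j) ℤ.*_) (≡.cong₂ ℤ._+_ (ℤₚ.*-zeroʳ (a zero j)) (ℤₚ.*-zeroʳ (b zero j))))
                   (ℤₚ.*-zeroʳ (signℤ (toℕ j)))))
  where
  a′ b′ : Fin (suc m) → Mat ℤ m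
  a′ j r c = a (suc r) (punchIn j c)
  b′ j r c = b (suc r) (punchIn j c)
  D = λ j → detₚ m (linearMatrix (a′ j) (b′ j))

detₚ-linear-monic : ∀ m (a : Mat ℤ m) → coeff (detₚ m (linearMatrix a (Matrices.δ ℤring m))) m ≡ + 1
detₚ-linear-monic zero    a = ≡.refl
detₚ-linear-monic (suc m) a = ≡.trans (coeff-detₚ-linear a δ m) (≡.trans
  (Σℤ.sum-single zero _ (λ j j≢0 → ≡.trans (term j) (≡.trans (≡.cong (λ x → signℤ (toℕ j) ℤ.* (x ℤ.* coeff (D j) m)) (δ-off (j≢0 ∘ ≡.sym)))
                                                       (≡.trans (≡.cong (signℤ (toℕ j) ℤ.*_) (ℤₚ.*-zeroˡ (coeff (D j) m))) (ℤₚ.*-zeroʳ (signℤ (toℕ j)))))))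
  (≡.trans (term zero) (≡.trans (ℤₚ.*-identityˡ _) (≡.trans (ℤₚ.*-identityˡ _) (detₚ-linear-monic m _)))))
  where
  open Matrices ℤring (suc m) using (δ; δ-off)
  D = λ j → detₚ m (linearMatrix (λ r c → a (suc r) (punchIn j c)) (λ r c → δ (suc r) (punchIn j c)))
  term : ∀ j → signℤ (toℕ j) ℤ.* (a zero j ℤ.* coeff (D j) (suc m) ℤ.+ δ zero j ℤ.* coeff (D j) m)
             ≡ signℤ (toℕ j) ℤ.* (δ zero j ℤ.* coeff (D j) m)
  term j = ≡.cong (signℤ (toℕ j) ℤ.*_) (≡.trans
    (≡.cong (λ x → a zero j ℤ.* x ℤ.+ δ zero j ℤ.* coeff (D j) m)
            (≡.trans (≡.cong (coeff (D j)) (ℕₚ.+-comm 1 m)) (detₚ-linear-degree m _ _ zero)))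
    (≡.trans (≡.cong (ℤ._+ δ zero j ℤ.* coeff (D j) m) (ℤₚ.*-zeroʳ (a zero j))) (ℤₚ.+-identityˡ _)))

charPoly-monic : ∀ {n} (A : Mat ℤ n) → coeff (charPoly A) n ≡ + 1
charPoly-monic {n} A = detₚ-linear-monic n (λ i j → ℤ.- A i j)

charPoly-degree : ∀ {n} (A : Mat ℤ n) k → coeff (charPoly A) (n ℕ.+ suc k) ≡ + 0
charPoly-degree {n} A = detₚ-linear-degree n (λ i j → ℤ.- A i j) (Matrices.δ ℤring n)

coeff-drop : ∀ N p k → coeff (drop N p) k ≡ coeff p (N ℕ.+ k)
coeff-drop zero    p       k = ≡.refl
coeff-drop (suc N) []      k = ≡.refl
coeff-drop (suc N) (a ∷ p) k = coeff-drop N p k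

module PowerExpansion {n} (A : Mat ℤ n) where
  open Evaluation A
  open Matrices ℤring n
  open Ring matrixRing
    using (setoid; semiring; +-cong; +-congˡ; +-assoc; +-identityˡ; +-identityʳ;
           *-congˡ; *-assoc; *-identityˡ; distribˡ; zeroʳ)
    renaming (sym to ≈ᴹ-sym; trans to ≈ᴹ-trans; reflexive to ≈ᴹ-reflexive)
  open import Algebra.Definitions.RawSemiring (Semiring.rawSemiring semiring) public using () renaming (_^_ to _^ᴹ_)
  open import Relation.Binary.Reasoning.Setoid setoid
  module Σᴹ = RingSums matrixRing

  powerSum : ∀ N → Poly → Matrix
  powerSum N p = Σᴹ.sum (λ (i : Fin N) → coeff p (toℕ i) • A ^ᴹ toℕ i)

  eval-split : ∀ N p → eval p ≈ᴹ powerSum N p +ᴹ A ^ᴹ N *ᴹ eval (drop N p)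
  eval-split zero    p       = ≈ᴹ-sym (≈ᴹ-trans (+-identityˡ _) (*-identityˡ (eval p)))
  eval-split (suc N) []      = ≈ᴹ-sym (≈ᴹ-trans (+-cong (Σᴹ.sum-zero (λ (i : Fin (suc N)) → (+ 0) • A ^ᴹ toℕ i) (λ i → •-zeroˡ (A ^ᴹ toℕ i))) (zeroʳ _)) (+-identityˡ 0ᴹ))
  eval-split (suc N) (a ∷ p) = begin
    a • 1ᴹ +ᴹ A *ᴹ eval p
      ≈⟨ +-congˡ (*-congˡ (eval-split N p)) ⟩
    a • 1ᴹ +ᴹ A *ᴹ (powerSum N p +ᴹ A ^ᴹ N *ᴹ eval (drop N p))
      ≈⟨ +-congˡ (≈ᴹ-trans (distribˡ A _ _) (+-cong shift (≈ᴹ-sym (*-assoc A (A ^ᴹ N) _)))) ⟩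
    a • 1ᴹ +ᴹ (Σᴹ.sum (λ (i : Fin N) → coeff p (toℕ i) • A ^ᴹ suc (toℕ i)) +ᴹ A ^ᴹ suc N *ᴹ eval (drop N p))
      ≈⟨ +-assoc _ _ _ ⟨
    powerSum (suc N) (a ∷ p) +ᴹ A ^ᴹ suc N *ᴹ eval (drop (suc N) (a ∷ p)) ∎
    where
    shift : A *ᴹ powerSum N p ≈ᴹ Σᴹ.sum (λ (i : Fin N) → coeff p (toℕ i) • A ^ᴹ suc (toℕ i))
    shift = ≈ᴹ-trans (Σᴹ.*-distribˡ-sum A (λ (i : Fin N) → coeff p (toℕ i) • A ^ᴹ toℕ i)) (Σᴹ.sum-cong-≋ {N} {λ i → A *ᴹ coeff p (toℕ i) • A ^ᴹ toℕ i} (λ i → •-*ᴹʳ (coeff p (toℕ i)) A (A ^ᴹ toℕ i)))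

  eval-zero : ∀ q → (∀ k → coeff q k ≡ + 0) → eval q ≈ᴹ 0ᴹ
  eval-zero []      _      = ≈ᴹ-sym (≈ᴹ-reflexive ≡.refl)
  eval-zero (a ∷ q) q≡0 = begin
    a • 1ᴹ +ᴹ A *ᴹ eval q   ≈⟨ +-cong (≈ᴹ-trans (≈ᴹ-reflexive (≡.cong (_• 1ᴹ) (q≡0 0))) (•-zeroˡ 1ᴹ))
                                      (≈ᴹ-trans (*-congˡ (eval-zero q (q≡0 ∘ suc))) (zeroʳ A)) ⟩
    0ᴹ +ᴹ 0ᴹ                ≈⟨ +-identityˡ 0ᴹ ⟩
    0ᴹ                      ∎

  eval-one : ∀ q → coeff q 0 ≡ + 1 → (∀ k → coeff q (suc k) ≡ + 0) → eval q ≈ᴹ 1ᴹ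
  eval-one (a ∷ q) a≡1 q≡0 = begin
    a • 1ᴹ +ᴹ A *ᴹ eval q   ≈⟨ +-cong (≈ᴹ-trans (≈ᴹ-reflexive (≡.cong (_• 1ᴹ) a≡1)) (•-identity 1ᴹ))
                                      (≈ᴹ-trans (*-congˡ (eval-zero q q≡0)) (zeroʳ A)) ⟩
    1ᴹ +ᴹ 0ᴹ                ≈⟨ +-identityʳ 1ᴹ ⟩
    1ᴹ                      ∎

-- Krylov matrices and the companion matrix

module _ {m : ℕ} (f : Poly) where
  open Matrices ℤring (suc m) using (δ; δ-diag; δ-off; _*ᴹ_; *ᴹ-entry)

  companion-shift : ∀ l (j : Fin m) → companion (suc m) f l (inject₁ j) ≡ δ l (suc j)
  companion-shift l j with toℕ (inject₁ j) ℕ.≡ᵇ m | ℕₚ.≡ᵇ⇒≡ (toℕ (inject₁ j)) m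
  ... | true  | j≡m = ⊥-elim (ℕₚ.<-irrefl (≡.trans (≡.sym (toℕ-inject₁ j)) (j≡m _)) (toℕ<n j))
  ... | false | _   = ≡.cong (λ x → if toℕ l ℕ.≡ᵇ suc x then + 1 else + 0) (toℕ-inject₁ j)

  companion-last : ∀ l c → toℕ c ≡ m → companion (suc m) f l c ≡ ℤ.- coeff f (toℕ l)
  companion-last l c c≡m with toℕ c ℕ.≡ᵇ m | ℕₚ.≡⇒≡ᵇ (toℕ c) m c≡m
  ... | true | _ = ≡.refl

  *ᴹ-companion-shift : ∀ X i (j : Fin m) → (X *ᴹ companion (suc m) f) i (inject₁ j) ≡ X i (suc j)
  *ᴹ-companion-shift X i j = ≡.trans (*ᴹ-entry X _ i (inject₁ j)) (≡.trans
    (Σℤ.sum-single (suc j) _ (λ l l≢ → ≡.trans (≡.cong (X i l ℤ.*_) (≡.trans (companion-shift l j) (δ-off l≢))) (ℤₚ.*-zeroʳ (X i l))))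
    (≡.trans (≡.cong (X i (suc j) ℤ.*_) (≡.trans (companion-shift (suc j) j) (δ-diag (suc j)))) (ℤₚ.*-identityʳ _)))

  *ᴹ-companion-last : ∀ X i c → toℕ c ≡ m →
    (X *ᴹ companion (suc m) f) i c ≡ Σℤ.sum (λ l → X i l ℤ.* ℤ.- coeff f (toℕ l))
  *ᴹ-companion-last X i c c≡m = ≡.trans (*ᴹ-entry X _ i c)
    (Σℤ.sum-cong-≗ (λ l → ≡.cong (X i l ℤ.*_) (companion-last l c c≡m)))

module _ {m} (A : Mat ℤ (suc m)) where
  open Matrices ℤring (suc m)
  open Evaluation A using (eval)
  open PowerExpansion A
  open Ring matrixRing using (setoid; +-congˡ; *-congˡ; *-identityʳ) renaming (sym to ≈ᴹ-sym; trans to ≈ᴹ-trans)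
  open import Relation.Binary.Reasoning.Setoid setoid

  cayleyHamilton-powers : powerSum (suc m) (charPoly A) +ᴹ A ^ᴹ suc m ≈ᴹ 0ᴹ
  cayleyHamilton-powers = begin
    powerSum (suc m) f +ᴹ A ^ᴹ suc m                       ≈⟨ +-congˡ (≈ᴹ-trans (*-congˡ eval-tail) (*-identityʳ _)) ⟨
    powerSum (suc m) f +ᴹ A ^ᴹ suc m *ᴹ eval (drop (suc m) f) ≈⟨ eval-split (suc m) f ⟨
    eval f                                                   ≈⟨ CayleyHamilton.cayleyHamilton A ⟩
    0ᴹ                                                       ∎
    where
    f = charPoly A
    eval-tail : eval (drop (suc m) f) ≈ᴹ 1ᴹ
    eval-tail = eval-one (drop (suc m) f)
      (≡.trans (coeff-drop (suc m) f 0) (≡.trans (≡.cong (coeff f) (ℕₚ.+-identityʳ (suc m))) (charPoly-monic A)))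
      (λ k → ≡.trans (coeff-drop (suc m) f (suc k)) (charPoly-degree A k))

module Krylov {m} (A Q : Mat ℤ (suc m)) where
  open Matrices ℤring (suc m)
  open PowerExpansion A using (_^ᴹ_; powerSum)
  open Ring matrixRing using (*-assoc; *-identityˡ; distribʳ; zeroˡ)
    renaming (sym to ≈ᴹ-sym; trans to ≈ᴹ-trans)
  module Σᴹ = RingSums matrixRing

  private
    f = charPoly A
    C = companion (suc m) f

  krylov : Mat ℤ (suc m)
  krylov i j = (A ^ᴹ toℕ j *ᴹ Q) i zero

  A*krylov-entry : ∀ i c → (A *ᴹ krylov) i c ≡ (A ^ᴹ suc (toℕ c) *ᴹ Q) i zero
  A*krylov-entry i c = ≡.trans (*ᴹ-entry A krylov i c)
    (≡.trans (≡.sym (*ᴹ-entry A (A ^ᴹ toℕ c *ᴹ Q) i zero)) (entry (≈ᴹ-sym (*-assoc A (A ^ᴹ toℕ c) Q)) i zero))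

  krylov-last-column : ∀ i → (A ^ᴹ suc m *ᴹ Q) i zero ≡ Σℤ.sum (λ l → krylov i l ℤ.* ℤ.- coeff f (toℕ l))
  krylov-last-column i = ≡.trans (inverseʳ-unique x y x+y≡0) (≡.trans (Σℤ.-‿distrib-sum (λ l → coeff f (toℕ l) ℤ.* krylov i l))
    (Σℤ.sum-cong-≗ (λ l → ≡.trans (ℤₚ.neg-distribˡ-* (coeff f (toℕ l)) (krylov i l)) (ℤₚ.*-comm (ℤ.- coeff f (toℕ l)) (krylov i l)))))
    where
    open import Algebra.Properties.Group (CommutativeRing.+-group ℤring) using (inverseʳ-unique)
    x = Σℤ.sum (λ (l : Fin (suc m)) → coeff f (toℕ l) ℤ.* krylov i l)
    y = (A ^ᴹ suc m *ᴹ Q) i zero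
    powerSum*Q : powerSum (suc m) f *ᴹ Q ≈ᴹ Σᴹ.sum (λ (l : Fin (suc m)) → coeff f (toℕ l) • (A ^ᴹ toℕ l *ᴹ Q))
    powerSum*Q = begin
      powerSum (suc m) f *ᴹ Q                                                ≈⟨ Σᴹ.*-distribʳ-sum Q (λ (l : Fin (suc m)) → coeff f (toℕ l) • A ^ᴹ toℕ l) ⟩
      Σᴹ.sum (λ (l : Fin (suc m)) → coeff f (toℕ l) • A ^ᴹ toℕ l *ᴹ Q)       ≈⟨ Σᴹ.sum-cong-≋ {suc m} {λ l → coeff f (toℕ l) • A ^ᴹ toℕ l *ᴹ Q} {λ l → coeff f (toℕ l) • (A ^ᴹ toℕ l *ᴹ Q)}
                                                                                   (λ l → •-*ᴹˡ (coeff f (toℕ l)) (A ^ᴹ toℕ l) Q) ⟩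
      Σᴹ.sum (λ (l : Fin (suc m)) → coeff f (toℕ l) • (A ^ᴹ toℕ l *ᴹ Q))     ∎
      where open import Relation.Binary.Reasoning.Setoid (Ring.setoid matrixRing)
    x+y≡0 : x ℤ.+ y ≡ + 0
    x+y≡0 = ≡.trans (≡.cong (ℤ._+ y) (≡.sym (≡.trans (entry powerSum*Q i zero)
                (≡.trans (sumᴹ-entry (λ (l : Fin (suc m)) → coeff f (toℕ l) • (A ^ᴹ toℕ l *ᴹ Q)) i zero)
                (Σℤ.sum-cong-≗ {suc m} {λ l → (coeff f (toℕ l) • (A ^ᴹ toℕ l *ᴹ Q)) i zero} {λ l → coeff f (toℕ l) ℤ.* krylov i l}
                   (λ l → •-entry (coeff f (toℕ l)) (A ^ᴹ toℕ l *ᴹ Q) i zero))))))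
      (≡.trans (≡.sym (+ᴹ-entry (powerSum (suc m) f *ᴹ Q) (A ^ᴹ suc m *ᴹ Q) i zero))
        (entry (≈ᴹ-trans (≈ᴹ-sym (distribʳ Q (powerSum (suc m) f) (A ^ᴹ suc m)))
                       (≈ᴹ-trans (Ring.*-congʳ matrixRing (cayleyHamilton-powers A)) (zeroˡ Q))) i zero))

  A*krylov≈krylov*C : A *ᴹ krylov ≈ᴹ krylov *ᴹ C
  A*krylov≈krylov*C = entrywise column
    where
    column : ∀ i c → (A *ᴹ krylov) i c ≡ (krylov *ᴹ C) i c
    column i c with m ℕ.≟ toℕ c
    ... | yes m≡c = ≡.trans (A*krylov-entry i c) (≡.trans (≡.cong (λ x → (A ^ᴹ suc x *ᴹ Q) i zero) (≡.sym m≡c))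
                      (≡.trans (krylov-last-column i) (≡.sym (*ᴹ-companion-last f krylov i c (≡.sym m≡c)))))
    ... | no m≢c with lower₁ c m≢c | inject₁-lower₁ c m≢c
    ...   | j | ≡.refl = ≡.trans (A*krylov-entry i (inject₁ j))
                          (≡.trans (≡.cong (λ x → (A ^ᴹ suc x *ᴹ Q) i zero) (toℕ-inject₁ j))
                                   (≡.sym (*ᴹ-companion-shift f krylov i j)))

  krylov≡ : ∀ {q} → A *ᴹ Q ≡ᴹ Q *ᴹ C [mod q ] → krylov ≡ᴹ Q [mod q ]
  krylov≡ {q} AQ≡QC = Matrices.entrywise λ i c → <-weakInduction (λ c → ∀ i → krylov i c ≡ Q i c [mod q ]) first next c i
    where
    open import Relation.Binary.Reasoning.Setoid (CommutativeRing.setoid (ℤmod q))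
    module Σq = RingSums (CommutativeRing.ring (ℤmod q))

    first : ∀ i → krylov i zero ≡ Q i zero [mod q ]
    first i = mod-reflexive (entry (*-identityˡ Q) i zero)

    next : ∀ j → (∀ i → krylov i (inject₁ j) ≡ Q i (inject₁ j) [mod q ]) → ∀ i → krylov i (suc j) ≡ Q i (suc j) [mod q ]
    next j IH i = begin
      krylov i (suc j)                           ≡⟨ ≡.trans (A*krylov-entry i (inject₁ j)) (≡.cong (λ x → (A ^ᴹ suc x *ᴹ Q) i zero) (toℕ-inject₁ j)) ⟨
      (A *ᴹ krylov) i (inject₁ j)                ≡⟨ *ᴹ-entry A krylov i (inject₁ j) ⟩
      Σℤ.sum (λ l → A i l ℤ.* krylov l (inject₁ j)) ≈⟨ Σq.sum-cong-≋ {suc m} {λ l → A i l ℤ.* krylov l (inject₁ j)} {λ l → A i l ℤ.* Q l (inject₁ j)}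
                                                       (λ l → mod-* (mod-reflexive {x = A i l} ≡.refl) (IH l)) ⟩
      Σℤ.sum (λ l → A i l ℤ.* Q l (inject₁ j))    ≡⟨ *ᴹ-entry A Q i (inject₁ j) ⟨
      (A *ᴹ Q) i (inject₁ j)                     ≈⟨ Matrices.entry AQ≡QC i (inject₁ j) ⟩
      (Q *ᴹ C) i (inject₁ j)                     ≡⟨ *ᴹ-companion-shift f Q i j ⟩
      Q i (suc j)                                ∎

sumℤ≡sum : ∀ {m} (f : Fin m → ℤ) → sumℤ f ≡ Σℤ.sum f
sumℤ≡sum {zero}  f = ≡.refl
sumℤ≡sum {suc m} f = ≡.cong (λ x → f zero ℤ.+ x) (sumℤ≡sum (λ j → f (suc j)))

module _ {n : ℕ} where
  open Matrices ℤring n using (_*ᴹ_; *ᴹ-entry)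

  ·≡ᴹ*ᴹ : ∀ {m} (X Y : Mat ℤ n) → X · Y ≡ᴹ X *ᴹ Y [mod m ]
  ·≡ᴹ*ᴹ X Y = Matrices.entrywise λ i k → mod-reflexive (≡.trans (sumℤ≡sum (λ j → X i j ℤ.* Y j k)) (≡.sym (*ᴹ-entry X Y i k)))

  fromMatCongMod : ∀ {m} {M N : Mat ℤ n} → MatCongMod m M N → M ≡ᴹ N [mod m ]
  fromMatCongMod M≡N = Matrices.entrywise λ i j → mod-intro (M≡N i j)

  toMatCongMod : ∀ {m} {M N : Mat ℤ n} → M ≡ᴹ N [mod m ] → MatCongMod m M N
  toMatCongMod M≡N i j = mod-elim (Matrices.entry M≡N i j)

similarOverℤp⇒similarModP : ∀ {n} p (A C : Mat ℤ n) → SimilarOverℤp p A C → SimilarModP p A C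
similarOverℤp⇒similarModP p A C (P , Q , P-similar) =
  P₁ , Q₁ , weaken (A · P₁) (P₁ · C) (proj₁ (P-similar 1))
          , weaken (P₁ · Q₁) idMat (proj₁ (proj₂ (P-similar 1)))
          , weaken (Q₁ · P₁) idMat (proj₂ (proj₂ (P-similar 1)))
  where
  P₁ = level P 1
  Q₁ = level Q 1
  weaken : ∀ X Y → MatCongMod (p ^ 1) X Y → MatCongMod p X Y
  weaken X Y X≡Y i j = mod-elim (mod-weakenˡ {p} {1} {X i j} {Y i j} (mod-intro (X≡Y i j)))

module KrylovLift {m} (A : Mat ℤ (suc m)) (p : ℕ) .{{_ : NonZero p}} (Q R : Mat ℤ (suc m))
  (AQ≡QC : MatCongMod p (A · Q) (Q · companion (suc m) (charPoly A)))
  (QR≡1 : MatCongMod p (Q · R) idMat) (RQ≡1 : MatCongMod p (R · Q) idMat) where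

  private
    C = companion (suc m) (charPoly A)
    module Mod (q : ℕ) where
      open Ring (Matrices.matrixRing (ℤmod q) (suc m)) public
      open import Relation.Binary.Reasoning.Setoid setoid public
  open Matrices ℤring (suc m) using (_*ᴹ_; 1ᴹ)
  open Krylov A Q

  krylov≡Q : krylov ≡ᴹ Q [mod p ]
  krylov≡Q = krylov≡ (begin
    A *ᴹ Q   ≈⟨ ·≡ᴹ*ᴹ A Q ⟨
    A · Q    ≈⟨ fromMatCongMod AQ≡QC ⟩
    Q · C    ≈⟨ ·≡ᴹ*ᴹ Q C ⟩
    Q *ᴹ C   ∎)
    where open Mod p

  krylov*R≡1 : krylov *ᴹ R ≡ᴹ 1ᴹ [mod p ]
  krylov*R≡1 = begin
    krylov *ᴹ R   ≈⟨ *-congʳ krylov≡Q ⟩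
    Q *ᴹ R        ≈⟨ ·≡ᴹ*ᴹ Q R ⟨
    Q · R         ≈⟨ fromMatCongMod QR≡1 ⟩
    1ᴹ            ∎
    where open Mod p

  R*krylov≡1 : R *ᴹ krylov ≡ᴹ 1ᴹ [mod p ]
  R*krylov≡1 = begin
    R *ᴹ krylov   ≈⟨ *-congˡ krylov≡Q ⟩
    R *ᴹ Q        ≈⟨ ·≡ᴹ*ᴹ R Q ⟨
    R · Q         ≈⟨ fromMatCongMod RQ≡1 ⟩
    1ᴹ            ∎
    where open Mod p

  open InverseLifting p krylov R krylov*R≡1 R*krylov≡1

  P P⁻¹ : Mat ℤ[ p ] (suc m)
  P   = padicMatrix p (λ _ → krylov) (λ _ → Mod.refl _)
  P⁻¹ = padicMatrix p rightInverse rightInverse-step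

  Pₖ≡krylov : ∀ k → level P k ≡ᴹ krylov [mod p ^ k ]
  Pₖ≡krylov = level-padicMatrix p (λ _ → krylov) (λ _ → Mod.refl _)

  P⁻¹ₖ≡rightInverse : ∀ k → level P⁻¹ k ≡ᴹ rightInverse k [mod p ^ k ]
  P⁻¹ₖ≡rightInverse = level-padicMatrix p rightInverse rightInverse-step

  A*Pₖ≡Pₖ*C : ∀ k → A · level P k ≡ᴹ level P k · C [mod p ^ k ]
  A*Pₖ≡Pₖ*C k = begin
    A · level P k         ≈⟨ ·≡ᴹ*ᴹ A (level P k) ⟩
    A *ᴹ level P k        ≈⟨ *-congˡ (Pₖ≡krylov k) ⟩
    A *ᴹ krylov           ≈⟨ Matrices.entrywise (λ i j → mod-reflexive (Matrices.entry A*krylov≈krylov*C i j)) ⟩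
    krylov *ᴹ C           ≈⟨ *-congʳ (Pₖ≡krylov k) ⟨
    level P k *ᴹ C        ≈⟨ ·≡ᴹ*ᴹ (level P k) C ⟨
    level P k · C         ∎
    where open Mod (p ^ k)

  Pₖ*P⁻¹ₖ≡1 : ∀ k → level P k · level P⁻¹ k ≡ᴹ idMat [mod p ^ k ]
  Pₖ*P⁻¹ₖ≡1 k = begin
    level P k · level P⁻¹ k    ≈⟨ ·≡ᴹ*ᴹ (level P k) (level P⁻¹ k) ⟩
    level P k *ᴹ level P⁻¹ k   ≈⟨ *-cong (Pₖ≡krylov k) (P⁻¹ₖ≡rightInverse k) ⟩
    krylov *ᴹ rightInverse k   ≈⟨ K*rightInverse k ⟩
    1ᴹ                         ∎
    where open Mod (p ^ k)

  P⁻¹ₖ*Pₖ≡1 : ∀ k → level P⁻¹ k · level P k ≡ᴹ idMat [mod p ^ k ]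
  P⁻¹ₖ*Pₖ≡1 k = begin
    level P⁻¹ k · level P k    ≈⟨ ·≡ᴹ*ᴹ (level P⁻¹ k) (level P k) ⟩
    level P⁻¹ k *ᴹ level P k   ≈⟨ *-cong (P⁻¹ₖ≡rightInverse k) (Pₖ≡krylov k) ⟩
    rightInverse k *ᴹ krylov   ≈⟨ rightInverse*K k ⟩
    1ᴹ                         ∎
    where open Mod (p ^ k)

  similarOverℤp : SimilarOverℤp p A C
  similarOverℤp = P , P⁻¹ , λ k →
    toMatCongMod (A*Pₖ≡Pₖ*C k) , toMatCongMod (Pₖ*P⁻¹ₖ≡1 k) , toMatCongMod (P⁻¹ₖ*Pₖ≡1 k)

similarModP⇒similarOverℤp : ∀ {m} (A : Mat ℤ (suc m)) p .{{_ : NonZero p}} →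
  SimilarModP p A (companion (suc m) (charPoly A)) → SimilarOverℤp p A (companion (suc m) (charPoly A))
similarModP⇒similarOverℤp A p (Q , R , AQ≡QC , QR≡1 , RQ≡1) = KrylovLift.similarOverℤp A p Q R AQ≡QC QR≡1 RQ≡1

mainTheorem15 : (n : ℕ) (A : Mat ℤ n) (p : ℕ) → Prime p →
    SimilarOverℤp p A (companion n (charPoly A)) ⇔ SimilarModP p A (companion n (charPoly A))
mainTheorem15 zero    A p _       =
  mk⇔ (similarOverℤp⇒similarModP p A (companion 0 (charPoly A))) (λ _ → (λ ()) , (λ ()) , λ _ → (λ ()) , (λ ()) , (λ ()))
mainTheorem15 (suc m) A p p-prime =
  mk⇔ (similarOverℤp⇒similarModP p A (companion (suc m) (charPoly A))) (similarModP⇒similarOverℤp A p {{prime⇒nonZero p-prime}})
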